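{- Let $n\geq 3$ and $3\leq k\leq 2^{n-1}$. Then $$\kappa^s(Q_n;P_k)\geq\begin{cases}\lceil\frac{2n}{k+1}\rceil & \text{if } k\text{ is odd},\\ \lceil\frac{2n}{k}\rceil & \text{if } k \text{ is even}.\end{cases}$$
   Context: $Q_n$ is the $n$-dimensional hypercube: its vertices are the binary strings of length $n$, two vertices being adjacent iff they differ in exactly one position. $P_k$ denotes the path with $k$ vertices. For connected graphs $G,H$, an $H$-substructure cut of $G$ is a set $F$ of subgraphs of $G$, each isomorphic to a connected subgraph of $H$, such that $G-V(F)$ is disconnected or trivial (a single vertex); $\kappa^s(G;H)$ is the minimum cardinality of an $H$-substructure cut of $G$. -}

module Defs where

open import Data.Bool using (Bool; true; false; if_then_else_)
open import Data.Nat using (ℕ; zero; suc; _+_; _*_; _∸_; _≤_; _/_; _%_; NonZero)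
open import Data.Nat.Properties using (_≟_)
open import Data.Vec using (Vec; []; _∷_)
open import Data.List using (List; []; _∷_; length)
open import Data.List.Membership.Propositional using (_∈_)
open import Data.List.Relation.Unary.Any using (Any)
open import Data.List.Relation.Unary.Unique.Propositional using (Unique)
open import Data.List.Relation.Unary.Linked using (Linked)
open import Data.Product using (Σ; ∃; _×_; _,_)
open import Data.Sum using (_⊎_)
open import Relation.Nullary using (¬_; does)
open import Relation.Binary.PropositionalEquality using (_≡_)

Vertex : ℕ → Set
Vertex n = Vec Bool n

hamming : ∀ {n} → Vertex n → Vertex n → ℕ
hamming [] [] = 0
hamming (x ∷ xs) (y ∷ ys) = (if does (Data.Bool._≟_ x y) then 0 else 1) + hamming xs ys

Adj : ∀ {n} → Vertex n → Vertex n → Set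
Adj u v = hamming u v ≡ 1

-- A subgraph of Q_n isomorphic to a connected subgraph of P_k, i.e. to
-- some path P_j with 1 ≤ j ≤ k, given by its vertex sequence v_1 … v_j :
-- nonempty, at most k vertices, pairwise distinct, consecutive ones adjacent.
record PathSub (n k : ℕ) : Set where
  constructor pathSub
  field
    verts    : List (Vertex n)
    nonempty : 1 ≤ length verts
    bounded  : length verts ≤ k
    distinct : Unique verts
    linked   : Linked Adj verts
open PathSub public

Covered : ∀ {n k} → List (PathSub n k) → Vertex n → Set
Covered F v = Any (λ P → v ∈ verts P) F

Remains : ∀ {n k} → List (PathSub n k) → Vertex n → Set
Remains F v = ¬ Covered F v

data Reach {n : ℕ} (R : Vertex n → Set) : Vertex n → Vertex n → Set where
  here  : ∀ {u} → Reach R u u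
  step  : ∀ {u w v} → Adj u w → R w → Reach R w v → Reach R u v

Disconnected : ∀ {n k} → List (PathSub n k) → Set
Disconnected {n} F = Σ (Vertex n) λ u → Σ (Vertex n) λ v →
  Remains F u × Remains F v × ¬ Reach (Remains F) u v

Trivial : ∀ {n k} → List (PathSub n k) → Set
Trivial {n} F = Σ (Vertex n) λ u → Remains F u × (∀ v → Remains F v → v ≡ u)

IsSubstructureCut : ∀ {n k} → List (PathSub n k) → Set
IsSubstructureCut F = Disconnected F ⊎ Trivial F

ceilDiv : (a b : ℕ) → .{{NonZero b}} → ℕ
ceilDiv a b = (a + b ∸ 1) / b

bound : (n k : ℕ) → ℕ
bound n zero = 0
bound n (suc k) with suc k % 2
... | 1 = ceilDiv (2 * n) (suc (suc k))
... | _ = ceilDiv (2 * n) (suc k)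

-- A path alternates between the two parity classes of Q_n, so a path on at most k
-- vertices meets each class in at most d/2 vertices, where d = k + 1 for odd k and d = k for even k.
-- Fewer than 2n/d paths therefore remove a set L with fewer than n vertices of each class. By
-- induction on n, starting from Q₃ where it is checked by computation, Q_n − L is then connected unless
-- L isolates an edge uv, i.e. contains all other neighbours of u and v. Those 2n − 2 vertices induce a
-- matching, so they would need at least n − 1 paths, too many. Finally every vertex keeps a live
-- neighbour, so Q_n − L is neither disconnected nor a single vertex.

module Submission where

open import Defs
open import Data.Bool using (Bool; true; false; not; _xor_; _∧_; _∨_; T; if_then_else_)
open import Data.Bool.Properties using (not-involutive; not-¬; ¬-not; not-distribˡ-xor; not-distribʳ-xor; T-≡; T-∧; T-∨)
  renaming (_≟_ to _≟ᵇ_)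
open import Data.Empty using (⊥; ⊥-elim)
open import Data.Fin using (Fin; zero; suc)
open import Data.Bool.ListAction using (any; all)
open import Data.List using (List; []; _∷_; length; _++_; map; concat; filter; filterᵇ)
open import Data.List.Membership.Propositional using (_∈_; _∉_; find; lose)
open import Data.List.Membership.Propositional.Properties
  using (∈-++⁺ˡ; ∈-++⁺ʳ; ∈-map⁺; ∈-map⁻; ∈-filter⁺; ∈-filter⁻; ∈-concat⁺; ∈-concat⁻; ∈-concat⁺′)
open import Data.List.Properties using (length-map; length-++; length-filter)
open import Data.List.Relation.Unary.All using (All; []; _∷_; all?; lookup)
import Data.List.Relation.Unary.All as All
open import Data.List.Relation.Unary.All.Properties using (all⁺; all⁻; ++⁺; ¬All⇒Any¬)
open import Data.List.Relation.Unary.Any using (Any; here; there; any?)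
import Data.List.Relation.Unary.Any as Any
import Data.List.Relation.Unary.Any.Properties as Any
open import Data.List.Relation.Unary.Any.Properties using (any⁺; any⁻)
open import Data.List.Relation.Unary.Linked using (Linked; []; [-]; _∷_)
open import Data.List.Relation.Unary.Unique.Propositional using (Unique; []; _∷_)
import Data.List.Relation.Unary.Unique.Propositional.Properties as Unique
open import Data.Nat using (ℕ; zero; suc; _+_; _*_; _∸_; _≤_; _<_; _^_; _/_; _%_; NonZero; z≤n; s≤s; s≤s⁻¹; _≤ᵇ_; _≡ᵇ_)
open import Data.Nat.DivMod using (m/n*n≤m; m≡m%n+[m/n]*n; m%n<n)
open import Data.Nat.Properties
open import Data.Nat.Tactic.RingSolver using (solve-∀)
open import Algebra.Properties.CommutativeSemigroup +-commutativeSemigroup using (x∙yz≈y∙xz)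
open import Data.Product using (Σ; _×_; _,_; proj₁; proj₂)
open import Data.Sum using (_⊎_; inj₁; inj₂; [_,_]′)
open import Data.Vec using ([]; _∷_)
open import Data.Vec.Properties using (≡-dec; ∷-injectiveˡ; ∷-injectiveʳ)
open import Function using (_∘_; Equivalence)
open import Relation.Binary.Definitions using (DecidableEquality)
open import Relation.Binary.PropositionalEquality
open import Relation.Nullary using (¬_; Dec; yes; no; does; ¬?)
open import Relation.Nullary.Decidable using (T?; _×-dec_)

private variable
  n : ℕ

_≟ᵛ_ : DecidableEquality (Vertex n)
_≟ᵛ_ = ≡-dec _≟ᵇ_

_∈ᵛ?_ : (x : Vertex n) (L : List (Vertex n)) → Dec (x ∈ L)
x ∈ᵛ? L = any? (x ≟ᵛ_) L

flip : Fin n → Vertex n → Vertex n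
flip zero    (x ∷ xs) = not x ∷ xs
flip (suc i) (x ∷ xs) = x ∷ flip i xs

parity : Vertex n → Bool
parity []       = false
parity (x ∷ xs) = x xor parity xs

hamming-cons-same : ∀ a (x y : Vertex n) → hamming (a ∷ x) (a ∷ y) ≡ hamming x y
hamming-cons-same true  x y = refl
hamming-cons-same false x y = refl

hamming-cons-not : ∀ a (x y : Vertex n) → hamming (a ∷ x) (not a ∷ y) ≡ suc (hamming x y)
hamming-cons-not true  x y = refl
hamming-cons-not false x y = refl

hamming-not-cons : ∀ a (x y : Vertex n) → hamming (not a ∷ x) (a ∷ y) ≡ suc (hamming x y)
hamming-not-cons true  x y = refl
hamming-not-cons false x y = refl

hamming-refl : (x : Vertex n) → hamming x x ≡ 0
hamming-refl []      = refl
hamming-refl (a ∷ x) = trans (hamming-cons-same a x x) (hamming-refl x)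

hamming≡0⇒≡ : (x y : Vertex n) → hamming x y ≡ 0 → x ≡ y
hamming≡0⇒≡ []          []          _ = refl
hamming≡0⇒≡ (true ∷ x)  (true ∷ y)  h = cong (true ∷_) (hamming≡0⇒≡ x y h)
hamming≡0⇒≡ (false ∷ x) (false ∷ y) h = cong (false ∷_) (hamming≡0⇒≡ x y h)

hamming-sym : (x y : Vertex n) → hamming x y ≡ hamming y x
hamming-sym []          []          = refl
hamming-sym (true ∷ x)  (true ∷ y)  = hamming-sym x y
hamming-sym (false ∷ x) (false ∷ y) = hamming-sym x y
hamming-sym (true ∷ x)  (false ∷ y) = cong suc (hamming-sym x y)
hamming-sym (false ∷ x) (true ∷ y)  = cong suc (hamming-sym x y)

Adj-sym : {x y : Vertex n} → Adj x y → Adj y x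
Adj-sym {x = x} {y} h = trans (hamming-sym y x) h

Adj-irrefl : {x : Vertex n} → ¬ Adj x x
Adj-irrefl {x = x} h with trans (sym (hamming-refl x)) h
... | ()

Adj-cons : ∀ a {x y : Vertex n} → Adj x y → Adj (a ∷ x) (a ∷ y)
Adj-cons a {x} {y} h = trans (hamming-cons-same a x y) h

Adj-not-cons : ∀ a (x : Vertex n) → Adj (a ∷ x) (not a ∷ x)
Adj-not-cons a x = trans (hamming-cons-not a x x) (cong suc (hamming-refl x))

Adj-cons-same⁻ : ∀ a (x y : Vertex n) → Adj (a ∷ x) (a ∷ y) → Adj x y
Adj-cons-same⁻ a x y h = trans (sym (hamming-cons-same a x y)) h

Adj-cons-not⁻ : ∀ a (x y : Vertex n) → Adj (a ∷ x) (not a ∷ y) → x ≡ y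
Adj-cons-not⁻ a x y h = hamming≡0⇒≡ x y (suc-injective (trans (sym (hamming-cons-not a x y)) h))

Adj-not-cons⁻ : ∀ a (x y : Vertex n) → Adj (not a ∷ x) (a ∷ y) → x ≡ y
Adj-not-cons⁻ a x y h = hamming≡0⇒≡ x y (suc-injective (trans (sym (hamming-not-cons a x y)) h))

Adj-cons⁻ : ∀ a b (x y : Vertex n) → Adj (a ∷ x) (b ∷ y) →
            (a ≡ b × Adj x y) ⊎ (b ≡ not a × x ≡ y)
Adj-cons⁻ true  true  x y h = inj₁ (refl , h)
Adj-cons⁻ false false x y h = inj₁ (refl , h)
Adj-cons⁻ true  false x y h = inj₂ (refl , Adj-cons-not⁻ true x y h)
Adj-cons⁻ false true  x y h = inj₂ (refl , Adj-cons-not⁻ false x y h)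

Adj-flip : ∀ i (x : Vertex n) → Adj x (flip i x)
Adj-flip zero    (a ∷ x) = Adj-not-cons a x
Adj-flip (suc i) (a ∷ x) = Adj-cons a {x} {flip i x} (Adj-flip i x)

Adj⇒flip : (x y : Vertex n) → Adj x y → Σ (Fin n) λ i → y ≡ flip i x
Adj⇒flip []      []      ()
Adj⇒flip (a ∷ x) (b ∷ y) h with Adj-cons⁻ a b x y h
... | inj₁ (refl , h′) = let (i , e) = Adj⇒flip x y h′ in suc i , cong (a ∷_) e
... | inj₂ (refl , refl) = zero , refl

flip-involutive : ∀ i (x : Vertex n) → flip i (flip i x) ≡ x
flip-involutive zero    (a ∷ x) = cong (_∷ x) (not-involutive a)
flip-involutive (suc i) (a ∷ x) = cong (a ∷_) (flip-involutive i x)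

parity-flip : ∀ i (x : Vertex n) → parity (flip i x) ≡ not (parity x)
parity-flip zero    (true ∷ x)  = sym (not-involutive _)
parity-flip zero    (false ∷ x) = refl
parity-flip (suc i) (true ∷ x)  = cong not (parity-flip i x)
parity-flip (suc i) (false ∷ x) = parity-flip i x

Adj⇒parity-not : {x y : Vertex n} → Adj x y → parity y ≡ not (parity x)
Adj⇒parity-not {x = x} {y} h with Adj⇒flip x y h
... | i , refl = parity-flip i x

flip-injective : ∀ i j (x : Vertex n) → flip i x ≡ flip j x → i ≡ j
flip-injective zero    zero    x       e = refl
flip-injective zero    (suc j) (a ∷ x) e = ⊥-elim (not-¬ refl (sym (∷-injectiveˡ e)))
flip-injective (suc i) zero    (a ∷ x) e = ⊥-elim (not-¬ refl (∷-injectiveˡ e))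
flip-injective (suc i) (suc j) (a ∷ x) e = cong suc (flip-injective i j x (∷-injectiveʳ e))

flip-flip≡id⇒≡ : ∀ j l (u : Vertex n) → u ≡ flip j (flip l u) → j ≡ l
flip-flip≡id⇒≡ j l u e = flip-injective j l u (trans (cong (flip j) e) (flip-involutive j (flip l u)))

-- flip i u and flip j (flip l u) already differ in coordinate l, so they must agree everywhere else.
Adj-flip-flip⇒≡ : ∀ i j l (u : Vertex n) → Adj (flip i u) (flip j (flip l u)) → i ≢ l → j ≢ l → i ≡ j
Adj-flip-flip⇒≡ zero    zero    zero    u h i≢l j≢l = refl
Adj-flip-flip⇒≡ zero    zero    (suc l) u h i≢l j≢l = refl
Adj-flip-flip⇒≡ zero    (suc j) zero    u h i≢l j≢l = ⊥-elim (i≢l refl)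
Adj-flip-flip⇒≡ (suc i) zero    zero    u h i≢l j≢l = ⊥-elim (j≢l refl)
Adj-flip-flip⇒≡ zero    (suc j) (suc l) (a ∷ u) h i≢l j≢l =
  ⊥-elim (j≢l (cong suc (flip-flip≡id⇒≡ j l u (Adj-not-cons⁻ a u _ h))))
Adj-flip-flip⇒≡ (suc i) zero    (suc l) (a ∷ u) h i≢l j≢l =
  ⊥-elim (i≢l (cong suc (flip-injective i l u (Adj-cons-not⁻ a (flip i u) _ h))))
Adj-flip-flip⇒≡ (suc i) (suc j) zero    (a ∷ u) h i≢l j≢l =
  cong suc (flip-injective i j u (Adj-cons-not⁻ a (flip i u) _ h))
Adj-flip-flip⇒≡ (suc i) (suc j) (suc l) (a ∷ u) h i≢l j≢l =
  cong suc (Adj-flip-flip⇒≡ i j l u (Adj-cons-same⁻ a (flip i u) _ h) (i≢l ∘ cong suc) (j≢l ∘ cong suc))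

-- Three corners u, v, z₂ of a square in Q_n determine the fourth.
fourth-corner-unique : (u v z₁ z₂ z₃ : Vertex n) → Adj u v →
  Adj u z₁ → z₁ ≢ v → Adj u z₃ → z₃ ≢ v → Adj v z₂ → z₂ ≢ u →
  Adj z₁ z₂ → Adj z₃ z₂ → z₁ ≡ z₃
fourth-corner-unique u v z₁ z₂ z₃ uv uz₁ z₁≢v uz₃ z₃≢v vz₂ z₂≢u z₁z₂ z₃z₂
  with Adj⇒flip u v uv | Adj⇒flip u z₁ uz₁ | Adj⇒flip u z₃ uz₃ | Adj⇒flip v z₂ vz₂
... | l , refl | i₁ , refl | i₃ , refl | j , refl =
  cong (λ i → flip i u) (trans (Adj-flip-flip⇒≡ i₁ j l u z₁z₂ (z₁≢v ∘ cong (λ i → flip i u)) j≢l)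
                               (sym (Adj-flip-flip⇒≡ i₃ j l u z₃z₂ (z₃≢v ∘ cong (λ i → flip i u)) j≢l)))
  where
  j≢l : j ≢ l
  j≢l refl = z₂≢u (flip-involutive l u)

module _ {A : Set} where

  countᵇ : (A → Bool) → List A → ℕ
  countᵇ f []       = 0
  countᵇ f (x ∷ xs) = (if f x then 1 else 0) + countᵇ f xs

  countᵇ-++ : ∀ f (xs ys : List A) → countᵇ f (xs ++ ys) ≡ countᵇ f xs + countᵇ f ys
  countᵇ-++ f []       ys = refl
  countᵇ-++ f (x ∷ xs) ys =
    trans (cong ((if f x then 1 else 0) +_) (countᵇ-++ f xs ys)) (sym (+-assoc (if f x then 1 else 0) _ _))

  countᵇ≤length : ∀ f (xs : List A) → countᵇ f xs ≤ length xs
  countᵇ≤length f []       = z≤n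
  countᵇ≤length f (x ∷ xs) with f x
  ... | true  = s≤s (countᵇ≤length f xs)
  ... | false = m≤n⇒m≤1+n (countᵇ≤length f xs)

  countᵇ-mono : ∀ (f g : A → Bool) (xs : List A) → (∀ x → f x ≡ true → g x ≡ true) →
                countᵇ f xs ≤ countᵇ g xs
  countᵇ-mono f g []       f⇒g = z≤n
  countᵇ-mono f g (x ∷ xs) f⇒g with f x in fx
  ... | true rewrite f⇒g x fx = s≤s (countᵇ-mono f g xs f⇒g)
  ... | false with g x
  ... | true  = m≤n⇒m≤1+n (countᵇ-mono f g xs f⇒g)
  ... | false = countᵇ-mono f g xs f⇒g

  countᵇ-mono-tight : ∀ (f g : A → Bool) (xs : List A) → (∀ x → f x ≡ true → g x ≡ true) →
                      countᵇ g xs ≤ countᵇ f xs → ∀ {z} → z ∈ xs → g z ≡ true → f z ≡ true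
  countᵇ-mono-tight f g (x ∷ xs) f⇒g g≤f (here refl) gz with f x in fx
  ... | true  = refl
  ... | false rewrite gz = ⊥-elim (<-irrefl refl (≤-trans (s≤s (countᵇ-mono f g xs f⇒g)) g≤f))
  countᵇ-mono-tight f g (x ∷ xs) f⇒g g≤f (there z∈xs) gz with f x in fx
  ... | true rewrite f⇒g x fx = countᵇ-mono-tight f g xs f⇒g (s≤s⁻¹ g≤f) z∈xs gz
  ... | false with g x
  ... | true  = countᵇ-mono-tight f g xs f⇒g (≤-trans (n≤1+n _) g≤f) z∈xs gz
  ... | false = countᵇ-mono-tight f g xs f⇒g g≤f z∈xs gz

  countᵇ-cong : ∀ (f g : A → Bool) (xs : List A) → (∀ x → f x ≡ g x) → countᵇ f xs ≡ countᵇ g xs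
  countᵇ-cong f g []       f≗g = refl
  countᵇ-cong f g (x ∷ xs) f≗g rewrite f≗g x = cong ((if g x then 1 else 0) +_) (countᵇ-cong f g xs f≗g)

  remove : (M : List A) {x : A} → x ∈ M → List A
  remove (y ∷ M) (here _)  = M
  remove (y ∷ M) (there p) = y ∷ remove M p

  countᵇ-remove : ∀ (f : A → Bool) {x} (M : List A) → f x ≡ true → (x∈M : x ∈ M) →
                  countᵇ f M ≡ suc (countᵇ f (remove M x∈M))
  countᵇ-remove f (y ∷ M) fx (here refl) rewrite fx = refl
  countᵇ-remove f (y ∷ M) fx (there x∈M) with f y
  ... | true  = cong suc (countᵇ-remove f M fx x∈M)
  ... | false = countᵇ-remove f M fx x∈M

  ∈-remove : ∀ {x z} (M : List A) (x∈M : x ∈ M) → z ∈ M → z ≢ x → z ∈ remove M x∈M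
  ∈-remove (y ∷ M) (here refl)  (here refl)  z≢x = ⊥-elim (z≢x refl)
  ∈-remove (y ∷ M) (here refl)  (there z∈M)  z≢x = z∈M
  ∈-remove (y ∷ M) (there x∈M)  (here refl)  z≢x = here refl
  ∈-remove (y ∷ M) (there x∈M)  (there z∈M)  z≢x = there (∈-remove M x∈M z∈M z≢x)

  Unique⇒length≤countᵇ : ∀ (f : A → Bool) (D M : List A) → Unique D →
                         All (λ d → d ∈ M × f d ≡ true) D → length D ≤ countᵇ f M
  Unique⇒length≤countᵇ f []      M _            _                 = z≤n
  Unique⇒length≤countᵇ f (d ∷ D) M (d∉D ∷ uniq) ((d∈M , fd) ∷ ds) rewrite countᵇ-remove f M fd d∈M =
    s≤s (Unique⇒length≤countᵇ f D (remove M d∈M) uniq (move D d∉D ds))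
    where
    move : ∀ D → All (d ≢_) D → All (λ e → e ∈ M × f e ≡ true) D →
           All (λ e → e ∈ remove M d∈M × f e ≡ true) D
    move []      _             _                 = []
    move (e ∷ D) (d≢e ∷ d∉D) ((e∈M , fe) ∷ es) = (∈-remove M d∈M e∈M (d≢e ∘ sym) , fe) ∷ move D d∉D es

  pigeonholeᵇ : DecidableEquality A → ∀ f (D M : List A) → Unique D → All (λ d → f d ≡ true) D →
                countᵇ f M < length D → Σ A λ d → d ∈ D × d ∉ M
  pigeonholeᵇ _≟_ f D M uniq fD count<|D| with all? (λ d → any? (d ≟_) M) D
  ... | yes D⊆M = ⊥-elim (<⇒≱ count<|D| (Unique⇒length≤countᵇ f D M uniq (All.zip (D⊆M , fD))))
  ... | no D⊈M  = find (¬All⇒Any¬ (λ d → any? (d ≟_) M) D D⊈M)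

  pigeonhole : DecidableEquality A → ∀ (D M : List A) → Unique D → length M < length D →
               Σ A λ d → d ∈ D × d ∉ M
  pigeonhole _≟_ D M uniq |M|<|D| =
    pigeonholeᵇ _≟_ (λ _ → true) D M uniq (All.tabulate (λ _ → refl)) (≤-<-trans (countᵇ≤length _ M) |M|<|D|)

  countᵇ≡0⇒ : ∀ f (M : List A) {a} → countᵇ f M ≡ 0 → a ∈ M → f a ≢ true
  countᵇ≡0⇒ f M count≡0 a∈M fa with Unique⇒length≤countᵇ f (_ ∷ []) M ([] ∷ []) ((a∈M , fa) ∷ [])
  ... | 1≤count = <-irrefl (sym count≡0) 1≤count

  countᵇ≤1⇒≡ : DecidableEquality A → ∀ f (M : List A) {a b} → countᵇ f M ≤ 1 →
               a ∈ M → b ∈ M → f a ≡ true → f b ≡ true → a ≡ b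
  countᵇ≤1⇒≡ _≟_ f M {a} {b} count≤1 a∈M b∈M fa fb with a ≟ b
  ... | yes a≡b = a≡b
  ... | no a≢b  = ⊥-elim (<⇒≱ (s≤s count≤1)
    (Unique⇒length≤countᵇ f (a ∷ b ∷ []) M ((a≢b ∷ []) ∷ [] ∷ []) ((a∈M , fa) ∷ (b∈M , fb) ∷ [])))

countᵇ-map : ∀ {A B : Set} (f : B → Bool) (g : A → B) (xs : List A) → countᵇ f (map g xs) ≡ countᵇ (f ∘ g) xs
countᵇ-map f g []       = refl
countᵇ-map f g (x ∷ xs) = cong ((if f (g x) then 1 else 0) +_) (countᵇ-map f g xs)

length-filterᵇ : ∀ {A : Set} (f : A → Bool) xs → length (filterᵇ f xs) ≡ countᵇ f xs
length-filterᵇ f []       = refl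
length-filterᵇ f (x ∷ xs) with f x
... | true  = cong suc (length-filterᵇ f xs)
... | false = length-filterᵇ f xs

neighbours : Vertex n → List (Vertex n)
neighbours []      = []
neighbours (a ∷ x) = (not a ∷ x) ∷ map (a ∷_) (neighbours x)

∈-neighbours⇒Adj : (u : Vertex n) {w : Vertex n} → w ∈ neighbours u → Adj u w
∈-neighbours⇒Adj (a ∷ x) (here refl) = Adj-not-cons a x
∈-neighbours⇒Adj (a ∷ x) (there w∈) with ∈-map⁻ (a ∷_) w∈
... | w′ , w′∈ , refl = Adj-cons a {x} {w′} (∈-neighbours⇒Adj x w′∈)

Adj⇒∈-neighbours : (u w : Vertex n) → Adj u w → w ∈ neighbours u
Adj⇒∈-neighbours []      []      ()
Adj⇒∈-neighbours (a ∷ x) (b ∷ y) h with Adj-cons⁻ a b x y h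
... | inj₁ (refl , h′)   = there (∈-map⁺ (a ∷_) (Adj⇒∈-neighbours x y h′))
... | inj₂ (refl , refl) = here refl

length-neighbours : (u : Vertex n) → length (neighbours u) ≡ n
length-neighbours []      = refl
length-neighbours (a ∷ x) = cong suc (trans (length-map (a ∷_) (neighbours x)) (length-neighbours x))

neighbours-unique : (u : Vertex n) → Unique (neighbours u)
neighbours-unique []      = []
neighbours-unique (a ∷ x) =
  All.tabulate (λ w∈ e → not-¬ refl (mate-in-half e w∈)) ∷ Unique.map⁺ ∷-injectiveʳ (neighbours-unique x)
  where
  mate-in-half : ∀ {w} → not a ∷ x ≡ w → w ∈ map (a ∷_) (neighbours x) → a ≡ not a
  mate-in-half refl w∈ with ∈-map⁻ (a ∷_) w∈
  ... | _ , _ , e = sym (∷-injectiveˡ e)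

vertices : ∀ n → List (Vertex n)
vertices zero    = [] ∷ []
vertices (suc n) = map (false ∷_) (vertices n) ++ map (true ∷_) (vertices n)

∈-vertices : (v : Vertex n) → v ∈ vertices n
∈-vertices []          = here refl
∈-vertices (false ∷ v) = ∈-++⁺ˡ (∈-map⁺ (false ∷_) (∈-vertices v))
∈-vertices (true ∷ v)  = ∈-++⁺ʳ _ (∈-map⁺ (true ∷_) (∈-vertices v))

vertices-unique : ∀ n → Unique (vertices n)
vertices-unique zero    = [] ∷ []
vertices-unique (suc n) =
  Unique.++⁺ (Unique.map⁺ ∷-injectiveʳ (vertices-unique n)) (Unique.map⁺ ∷-injectiveʳ (vertices-unique n)) disjoint
  where
  disjoint : ∀ {v} → v ∈ map (false ∷_) (vertices n) × v ∈ map (true ∷_) (vertices n) → ⊥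
  disjoint (v∈₀ , v∈₁) with ∈-map⁻ (false ∷_) v∈₀ | ∈-map⁻ (true ∷_) v∈₁
  ... | _ , _ , refl | _ , _ , ()

length-vertices : ∀ n → length (vertices n) ≡ 2 ^ n
length-vertices zero    = refl
length-vertices (suc n) = begin
  length (map (false ∷_) (vertices n) ++ map (true ∷_) (vertices n))
    ≡⟨ length-++ (map (false ∷_) (vertices n)) ⟩
  length (map (false ∷_) (vertices n)) + length (map (true ∷_) (vertices n))
    ≡⟨ cong₂ _+_ (length-map _ (vertices n)) (length-map _ (vertices n)) ⟩
  length (vertices n) + length (vertices n)
    ≡⟨ cong₂ _+_ (length-vertices n) (trans (length-vertices n) (sym (+-identityʳ _))) ⟩
  2 ^ suc n ∎
  where open ≡-Reasoning

-- Parity classes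

hasParity : Bool → Vertex n → Bool
hasParity q v = not (parity v xor q)

countParity : Bool → List (Vertex n) → ℕ
countParity q = countᵇ (hasParity q)

hasParity⇒≡ : ∀ q (v : Vertex n) → hasParity q v ≡ true → parity v ≡ q
hasParity⇒≡ q v h with parity v | q
... | true  | true  = refl
... | false | false = refl

≡⇒hasParity : ∀ q (v : Vertex n) → parity v ≡ q → hasParity q v ≡ true
≡⇒hasParity q v refl with parity v
... | true  = refl
... | false = refl

hasParity-parity : (v : Vertex n) → hasParity (parity v) v ≡ true
hasParity-parity v = ≡⇒hasParity (parity v) v refl

hasParity-not : ∀ q (v : Vertex n) → hasParity (not q) v ≡ not (hasParity q v)
hasParity-not q v = cong not (sym (not-distribʳ-xor (parity v) q))

hasParity-not⇒false : ∀ q (v : Vertex n) → hasParity (not q) v ≡ true → hasParity q v ≡ false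
hasParity-not⇒false q v h with hasParity q v | hasParity-not q v
... | false | _ = refl
... | true  | e = ⊥-elim (not-¬ refl (trans (sym h) e))

hasParity⇒not-false : ∀ q (v : Vertex n) → hasParity q v ≡ true → hasParity (not q) v ≡ false
hasParity⇒not-false q v h = trans (hasParity-not q v) (cong not h)

hasParity-contra : ∀ q (v : Vertex n) → hasParity q v ≡ true → hasParity (not q) v ≡ true → ⊥
hasParity-contra q v h h′ with trans (sym h′) (hasParity⇒not-false q v h)
... | ()

hasParity-either : ∀ q (v : Vertex n) → hasParity q v ≡ true ⊎ hasParity (not q) v ≡ true
hasParity-either q v with hasParity q v in h
... | true  = inj₁ refl
... | false = inj₂ (trans (hasParity-not q v) (cong not h))

Adj⇒hasParity-not : ∀ q {u w : Vertex n} → Adj u w → hasParity q u ≡ true → hasParity (not q) w ≡ true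
Adj⇒hasParity-not q {u} {w} uw h =
  ≡⇒hasParity (not q) w (trans (Adj⇒parity-not {x = u} {w} uw) (cong not (hasParity⇒≡ q u h)))

hasParity-true∷ : ∀ q (t : Vertex n) → hasParity q (true ∷ t) ≡ hasParity (not q) t
hasParity-true∷ q t = cong not (trans (sym (not-distribˡ-xor (parity t) q)) (not-distribʳ-xor (parity t) q))

neighbours-parity : (u : Vertex n) → All (λ w → hasParity (not (parity u)) w ≡ true) (neighbours u)
neighbours-parity u =
  All.tabulate (λ {w} w∈ → Adj⇒hasParity-not (parity u) {u} {w} (∈-neighbours⇒Adj u w∈) (hasParity-parity u))

length≡countParity+countParity : ∀ q (M : List (Vertex n)) → length M ≡ countParity q M + countParity (not q) M
length≡countParity+countParity q []      = refl
length≡countParity+countParity q (v ∷ M) rewrite hasParity-not q v | length≡countParity+countParity q M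
  with hasParity q v
... | true  = refl
... | false = sym (+-suc _ _)

countParity-vertices : ∀ n q → countParity q (vertices (suc n)) ≡ 2 ^ n
countParity-vertices zero    true  = refl
countParity-vertices zero    false = refl
countParity-vertices (suc n) q = begin
  countParity q (map (false ∷_) (vertices (suc n)) ++ map (true ∷_) (vertices (suc n)))
    ≡⟨ countᵇ-++ (hasParity q) (map (false ∷_) (vertices (suc n))) _ ⟩
  countᵇ (hasParity q) (map (false ∷_) (vertices (suc n))) + countᵇ (hasParity q) (map (true ∷_) (vertices (suc n)))
    ≡⟨ cong₂ _+_ (countᵇ-map (hasParity q) (false ∷_) (vertices (suc n)))
                 (trans (countᵇ-map (hasParity q) (true ∷_) (vertices (suc n)))
                        (countᵇ-cong _ (hasParity (not q)) (vertices (suc n)) (hasParity-true∷ q))) ⟩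
  countParity q (vertices (suc n)) + countParity (not q) (vertices (suc n))
    ≡⟨ cong₂ _+_ (countParity-vertices n q) (trans (countParity-vertices n (not q)) (sym (+-identityʳ _))) ⟩
  2 ^ suc n ∎
  where open ≡-Reasoning

half : Bool → List (Vertex (suc n)) → List (Vertex n)
half b            []            = []
half false ((false ∷ t) ∷ L) = t ∷ half false L
half false ((true ∷ t) ∷ L)  = half false L
half true  ((false ∷ t) ∷ L) = half true L
half true  ((true ∷ t) ∷ L)  = t ∷ half true L

∈-half⁺ : ∀ b {t : Vertex n} (L : List (Vertex (suc n))) → (b ∷ t) ∈ L → t ∈ half b L
∈-half⁺ false ((false ∷ t) ∷ L) (here refl) = here refl
∈-half⁺ true  ((true ∷ t) ∷ L)  (here refl) = here refl
∈-half⁺ false ((false ∷ t) ∷ L) (there p)   = there (∈-half⁺ false L p)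
∈-half⁺ false ((true ∷ t) ∷ L)  (there p)   = ∈-half⁺ false L p
∈-half⁺ true  ((false ∷ t) ∷ L) (there p)   = ∈-half⁺ true L p
∈-half⁺ true  ((true ∷ t) ∷ L)  (there p)   = there (∈-half⁺ true L p)

∈-half⁻ : ∀ b {t : Vertex n} (L : List (Vertex (suc n))) → t ∈ half b L → (b ∷ t) ∈ L
∈-half⁻ false ((false ∷ t) ∷ L) (here refl) = here refl
∈-half⁻ true  ((true ∷ t) ∷ L)  (here refl) = here refl
∈-half⁻ false ((false ∷ t) ∷ L) (there p)   = there (∈-half⁻ false L p)
∈-half⁻ false ((true ∷ t) ∷ L)  p           = there (∈-half⁻ false L p)
∈-half⁻ true  ((false ∷ t) ∷ L) p           = there (∈-half⁻ true L p)
∈-half⁻ true  ((true ∷ t) ∷ L)  (there p)   = there (∈-half⁻ true L p)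

length-halves : (L : List (Vertex (suc n))) → length L ≡ length (half false L) + length (half true L)
length-halves []                = refl
length-halves ((false ∷ t) ∷ L) = cong suc (length-halves L)
length-halves ((true ∷ t) ∷ L)  = trans (cong suc (length-halves L)) (sym (+-suc _ _))

countParity-halves : ∀ q (L : List (Vertex (suc n))) →
                     countParity q L ≡ countParity q (half false L) + countParity (not q) (half true L)
countParity-halves q []                = refl
countParity-halves q ((false ∷ t) ∷ L) =
  trans (cong (bit +_) (countParity-halves q L)) (sym (+-assoc bit _ _))
  where
  bit : ℕ
  bit = if hasParity q t then 1 else 0
countParity-halves q ((true ∷ t) ∷ L) rewrite hasParity-true∷ q t = begin
  bit + countParity q L                                                   ≡⟨ cong (bit +_) (countParity-halves q L) ⟩
  bit + (countParity q (half false L) + countParity (not q) (half true L)) ≡⟨ x∙yz≈y∙xz bit (countParity q (half false L)) _ ⟩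
  countParity q (half false L) + (bit + countParity (not q) (half true L)) ∎
  where
  bit : ℕ
  bit = if hasParity (not q) t then 1 else 0
  open ≡-Reasoning

half-parity : ∀ q b (L : List (Vertex (suc n))) → All (λ v → hasParity q v ≡ true) L →
              All (λ t → hasParity (b xor q) t ≡ true) (half b L)
half-parity q b     []                _        = []
half-parity q false ((false ∷ t) ∷ L) (p ∷ ps) = p ∷ half-parity q false L ps
half-parity q false ((true ∷ t) ∷ L)  (p ∷ ps) = half-parity q false L ps
half-parity q true  ((false ∷ t) ∷ L) (p ∷ ps) = half-parity q true L ps
half-parity q true  ((true ∷ t) ∷ L)  (p ∷ ps) = trans (sym (hasParity-true∷ q t)) p ∷ half-parity q true L ps

module _ {R : Vertex n → Set} where

  Reach-trans : ∀ {u w v} → Reach R u w → Reach R w v → Reach R u v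
  Reach-trans here           q = q
  Reach-trans (step uw Rw p) q = step uw Rw (Reach-trans p q)

  Reach-single : ∀ {u v} → Adj u v → R v → Reach R u v
  Reach-single uv Rv = step uv Rv here

  Reach-sym : ∀ {u v} → R u → Reach R u v → Reach R v u
  Reach-sym Ru here                       = here
  Reach-sym {u} Ru (step {w = w} uw Rw p) =
    Reach-trans (Reach-sym Rw p) (Reach-single (Adj-sym {x = u} {w} uw) Ru)

Reach-mono : {R R′ : Vertex n → Set} → (∀ x → R x → R′ x) → ∀ {u v} → Reach R u v → Reach R′ u v
Reach-mono R⇒R′ here           = here
Reach-mono R⇒R′ (step uw Rw p) = step uw (R⇒R′ _ Rw) (Reach-mono R⇒R′ p)

Reach-cons : {R : Vertex (suc n) → Set} → ∀ c {t t′ : Vertex n} →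
             Reach (λ s → R (c ∷ s)) t t′ → Reach R (c ∷ t) (c ∷ t′)
Reach-cons c here                   = here
Reach-cons c (step {t} {w} tw Rw p) = step (Adj-cons c {t} {w} tw) Rw (Reach-cons c p)

Reach-everywhere : (R : Vertex n → Set) → (∀ v → R v) → ∀ t t′ → Reach R t t′
Reach-everywhere R all-R []      []       = here
Reach-everywhere R all-R (a ∷ t) (b ∷ t′) =
  Reach-trans (Reach-cons a (Reach-everywhere (λ s → R (a ∷ s)) (λ v → all-R (a ∷ v)) t t′)) (switch a b)
  where
  switch : ∀ a b → Reach R (a ∷ t′) (b ∷ t′)
  switch true  true  = here
  switch false false = here
  switch true  false = Reach-single (Adj-not-cons true t′) (all-R _)
  switch false true  = Reach-single (Adj-not-cons false t′) (all-R _)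

Alive : List (Vertex n) → Vertex n → Set
Alive L v = v ∉ L

Connected : List (Vertex n) → Set
Connected {n} L = ∀ (x y : Vertex n) → x ∉ L → y ∉ L → Reach (Alive L) x y

Reach-half : ∀ b (L : List (Vertex (suc n))) {t t′} → Reach (Alive (half b L)) t t′ →
             Reach (Alive L) (b ∷ t) (b ∷ t′)
Reach-half b L p = Reach-cons b (Reach-mono (λ t t∉ → t∉ ∘ ∈-half⁺ b L) p)

Reach-across : (L : List (Vertex (suc n))) → ∀ a c (s : Vertex n) → (c ∷ s) ∉ L →
               Reach (Alive L) (a ∷ s) (c ∷ s)
Reach-across L true  true  s c∷s∉L = here
Reach-across L false false s c∷s∉L = here
Reach-across L true  false s c∷s∉L = Reach-single (Adj-not-cons true s) c∷s∉L
Reach-across L false true  s c∷s∉L = Reach-single (Adj-not-cons false s) c∷s∉L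

half-empty⇒Connected : (L : List (Vertex (suc n))) → ∀ c → (∀ t → (c ∷ t) ∉ L) → Connected L
half-empty⇒Connected L c empty (a ∷ s) (b ∷ s′) a∷s∉L b∷s′∉L =
  Reach-trans (Reach-across L a c s (empty s))
    (Reach-trans (Reach-cons c (Reach-everywhere (λ t → Alive L (c ∷ t)) empty s s′))
      (Reach-sym b∷s′∉L (Reach-across L b c s′ (empty s′))))

HasAliveNeighbour : List (Vertex n) → Vertex n → Set
HasAliveNeighbour {n} L x = Σ (Vertex n) λ z → Adj x z × z ∉ L

hasAliveNeighbour? : (M : List (Vertex n)) → ∀ s → Dec (HasAliveNeighbour M s)
hasAliveNeighbour? M s with any? (λ z → ¬? (z ∈ᵛ? M)) (neighbours s)
... | yes found = let (z , z∈ , z∉M) = find found in yes (z , ∈-neighbours⇒Adj s z∈ , z∉M)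
... | no none   = no λ (z , sz , z∉M) → none (Any.map (λ { refl → z∉M }) (Adj⇒∈-neighbours s z sz))

¬HasAliveNeighbour⇒ : (M : List (Vertex n)) → ∀ s → ¬ HasAliveNeighbour M s → ∀ z → Adj s z → z ∈ M
¬HasAliveNeighbour⇒ M s none z sz with z ∈ᵛ? M
... | yes z∈M = z∈M
... | no z∉M  = ⊥-elim (none (z , sz , z∉M))

length<⇒HasAliveNeighbour : (M : List (Vertex n)) → length M < n → ∀ s → HasAliveNeighbour M s
length<⇒HasAliveNeighbour M |M|<n s
  with pigeonhole _≟ᵛ_ (neighbours s) M (neighbours-unique s) (subst (length M <_) (sym (length-neighbours s)) |M|<n)
... | z , z∈ , z∉M = z , ∈-neighbours⇒Adj s z∈ , z∉M

countParity<⇒HasAliveNeighbour : (L : List (Vertex n)) → ∀ w → countParity (not (parity w)) L < n →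
                                 HasAliveNeighbour L w
countParity<⇒HasAliveNeighbour L w count<n
  with pigeonholeᵇ _≟ᵛ_ (hasParity (not (parity w))) (neighbours w) L (neighbours-unique w) (neighbours-parity w)
         (subst (countParity (not (parity w)) L <_) (sym (length-neighbours w)) count<n)
... | z , z∈ , z∉L = z , ∈-neighbours⇒Adj w z∈ , z∉L

CoversNeighboursExcept : List (Vertex n) → Vertex n → Vertex n → Set
CoversNeighboursExcept L u v = ∀ w → Adj u w → w ≢ v → w ∈ L

IsolatesEdge : List (Vertex n) → Set
IsolatesEdge {n} L = Σ (Vertex n) λ u → Σ (Vertex n) λ v → Adj u v × u ∉ L × v ∉ L ×
  CoversNeighboursExcept L u v × CoversNeighboursExcept L v u

CoversNeighboursExcept⇒n≤1+countᵇ : ∀ (f : Vertex n → Bool) (M : List (Vertex n)) u v → CoversNeighboursExcept M u v →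
  (∀ w → Adj u w → f w ≡ true) → n ≤ suc (countᵇ f M)
CoversNeighboursExcept⇒n≤1+countᵇ {n} f M u v covers f-neighbours = begin
  n                                     ≡⟨ length-neighbours u ⟨
  length (neighbours u)                 ≤⟨ Unique⇒length≤countᵇ f (neighbours u) (v ∷ M) (neighbours-unique u)
                                             (All.tabulate (λ w∈ → in-v∷M w∈ , f-neighbours _ (∈-neighbours⇒Adj u w∈))) ⟩
  (if f v then 1 else 0) + countᵇ f M   ≤⟨ +-monoˡ-≤ _ (bit≤1 (f v)) ⟩
  suc (countᵇ f M)                      ∎
  where
  open ≤-Reasoning
  in-v∷M : ∀ {w} → w ∈ neighbours u → w ∈ v ∷ M
  in-v∷M {w} w∈ with w ≟ᵛ v
  ... | yes refl = here refl
  ... | no w≢v   = there (covers w (∈-neighbours⇒Adj u w∈) w≢v)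
  bit≤1 : ∀ b → (if b then 1 else 0) ≤ 1
  bit≤1 true  = ≤-refl
  bit≤1 false = z≤n

CoversNeighboursExcept⇒n≤1+countParity : (M : List (Vertex n)) → ∀ u v → CoversNeighboursExcept M u v →
                                         n ≤ suc (countParity (not (parity u)) M)
CoversNeighboursExcept⇒n≤1+countParity M u v covers =
  CoversNeighboursExcept⇒n≤1+countᵇ (hasParity (not (parity u))) M u v covers
    (λ w uw → Adj⇒hasParity-not (parity u) {u} {w} uw (hasParity-parity u))

IsolatesEdge⇒n≤1+countParity : (M : List (Vertex n)) → IsolatesEdge M → ∀ q → n ≤ suc (countParity q M)
IsolatesEdge⇒n≤1+countParity M (u , v , uv , _ , _ , covers-u , covers-v) q with q ≟ᵇ parity u
... | no q≢     = subst (λ q → _ ≤ suc (countParity q M)) (sym (¬-not q≢))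
                   (CoversNeighboursExcept⇒n≤1+countParity M u v covers-u)
... | yes refl = subst (λ q → _ ≤ suc (countParity q M)) q≡
                   (CoversNeighboursExcept⇒n≤1+countParity M v u covers-v)
  where
  q≡ : not (parity v) ≡ parity u
  q≡ = trans (cong not (Adj⇒parity-not {x = u} {v} uv)) (not-involutive (parity u))

-- The base case Q₃, by exhaustive search

adjacentᵇ : Vertex n → Vertex n → Bool
adjacentᵇ x y = hamming x y ≡ᵇ 1

adjacentᵇ⇒Adj : (x y : Vertex n) → T (adjacentᵇ x y) → Adj x y
adjacentᵇ⇒Adj x y = ≡ᵇ⇒≡ (hamming x y) 1

Adj⇒adjacentᵇ : (x y : Vertex n) → Adj x y → T (adjacentᵇ x y)
Adj⇒adjacentᵇ x y = ≡⇒≡ᵇ (hamming x y) 1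

⇒ᵇ-elim : ∀ {a b} → T (not a ∨ b) → T a → T b
⇒ᵇ-elim {true} b _ = b

T-does⇒ : {P : Set} (P? : Dec P) → T (does P?) → P
T-does⇒ (yes p) _ = p

T-not⇒¬T : ∀ {b} → T (not b) → ¬ T b
T-not⇒¬T {false} _ ()

T-∧-intro : ∀ {a b} → T a → T b → T (a ∧ b)
T-∧-intro ta tb = Equivalence.from T-∧ (ta , tb)

all-vertices⇒ : (p : Vertex n → Bool) → T (all p (vertices n)) → ∀ v → T (p v)
all-vertices⇒ p h v = All.lookup (all⁺ p (vertices _) h) (∈-vertices v)

any-vertices⇒ : (p : Vertex n → Bool) → T (any p (vertices n)) → Σ (Vertex n) λ v → T (p v)
any-vertices⇒ p h = let (v , _ , pv) = find (any⁻ p (vertices _) h) in v , pv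

module Search {n : ℕ} (alive : Vertex n → Bool) where

  Aliveᵇ : Vertex n → Set
  Aliveᵇ v = T (alive v)

  frontier : List (Vertex n) → Vertex n → Bool
  frontier S v = alive v ∧ any (λ w → adjacentᵇ w v) S

  grow : List (Vertex n) → List (Vertex n)
  grow S = S ++ filterᵇ (frontier S) (vertices n)

  explore : ℕ → List (Vertex n) → List (Vertex n)
  explore zero    S = S
  explore (suc k) S = explore k (grow S)

  grow-reachable : ∀ x S → All (Reach Aliveᵇ x) S → All (Reach Aliveᵇ x) (grow S)
  grow-reachable x S reachable = ++⁺ reachable (All.tabulate new)
    where
    new : ∀ {v} → v ∈ filterᵇ (frontier S) (vertices n) → Reach Aliveᵇ x v
    new {v} v∈ with Equivalence.to T-∧ (proj₂ (∈-filter⁻ (T? ∘ frontier S) {xs = vertices n} v∈))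
    ... | alive-v , adjacent with find (any⁻ _ S adjacent)
    ... | w , w∈S , wv = Reach-trans (All.lookup reachable w∈S) (Reach-single (adjacentᵇ⇒Adj w v wv) alive-v)

  explore-reachable : ∀ x k S → All (Reach Aliveᵇ x) S → All (Reach Aliveᵇ x) (explore k S)
  explore-reachable x zero    S reachable = reachable
  explore-reachable x (suc k) S reachable = explore-reachable x k (grow S) (grow-reachable x S reachable)

  -- Seven rounds of search reach everything reachable, as there are only eight vertices when n = 3.
  reachedᵇ : Vertex n → Vertex n → Bool
  reachedᵇ x y = does (y ∈ᵛ? explore 7 (x ∷ []))

  connectedᵇ : (Vertex n → Bool) → Bool
  connectedᵇ ok = all (λ x → not (ok x) ∨ all (λ y → not (ok y) ∨ reachedᵇ x y) (vertices n)) (vertices n)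

  connectedᵇ-sound : ∀ ok → T (connectedᵇ ok) → ∀ x y → T (ok x) → T (ok y) → Reach Aliveᵇ x y
  connectedᵇ-sound ok h x y ok-x ok-y =
    All.lookup (explore-reachable x 7 (x ∷ []) (here ∷ [])) (T-does⇒ (y ∈ᵛ? explore 7 (x ∷ [])) reached)
    where
    reached : T (reachedᵇ x y)
    reached = ⇒ᵇ-elim (all-vertices⇒ (λ y → not (ok y) ∨ reachedᵇ x y)
                (⇒ᵇ-elim (all-vertices⇒ (λ x → not (ok x) ∨ all (λ y → not (ok y) ∨ reachedᵇ x y) (vertices n)) h x) ok-x)
                y) ok-y

  hasAliveNeighbourᵇ : Vertex n → Bool
  hasAliveNeighbourᵇ x = any (λ z → adjacentᵇ x z ∧ alive z) (vertices n)

  coversNeighboursExceptᵇ : Vertex n → Vertex n → Bool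
  coversNeighboursExceptᵇ u v = all (λ w → not (adjacentᵇ u w) ∨ (does (w ≟ᵛ v) ∨ not (alive w))) (vertices n)

  isolatedEdgeᵇ : Vertex n → Vertex n → Bool
  isolatedEdgeᵇ u v = alive u ∧ alive v ∧ adjacentᵇ u v ∧ coversNeighboursExceptᵇ u v ∧ coversNeighboursExceptᵇ v u

  isolatesEdgeᵇ : Bool
  isolatesEdgeᵇ = any (λ u → any (isolatedEdgeᵇ u) (vertices n)) (vertices n)

  coversNeighboursExceptᵇ-sound : ∀ u v → T (coversNeighboursExceptᵇ u v) → ∀ w → Adj u w → w ≢ v → ¬ Aliveᵇ w
  coversNeighboursExceptᵇ-sound u v h w uw w≢v alive-w
    with Equivalence.to T-∨ (⇒ᵇ-elim (all-vertices⇒ (λ w → not (adjacentᵇ u w) ∨ (does (w ≟ᵛ v) ∨ not (alive w))) h w)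
                                     (Adj⇒adjacentᵇ u w uw))
  ... | inj₁ w≡v  = w≢v (T-does⇒ (w ≟ᵛ v) w≡v)
  ... | inj₂ removed = T-not⇒¬T removed alive-w

  isolatesEdgeᵇ-sound : T isolatesEdgeᵇ → Σ (Vertex n) λ u → Σ (Vertex n) λ v → Adj u v × Aliveᵇ u × Aliveᵇ v ×
    (∀ w → Adj u w → w ≢ v → ¬ Aliveᵇ w) × (∀ w → Adj v w → w ≢ u → ¬ Aliveᵇ w)
  isolatesEdgeᵇ-sound h with any-vertices⇒ (λ u → any (isolatedEdgeᵇ u) (vertices n)) h
  ... | u , h′ with any-vertices⇒ (isolatedEdgeᵇ u) h′
  ... | v , edge with Equivalence.to T-∧ edge
  ... | alive-u , edge′ with Equivalence.to T-∧ edge′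
  ... | alive-v , edge″ with Equivalence.to T-∧ edge″
  ... | uv , covers with Equivalence.to T-∧ covers
  ... | covers-u , covers-v =
    u , v , adjacentᵇ⇒Adj u v uv , alive-u , alive-v ,
    coversNeighboursExceptᵇ-sound u v covers-u , coversNeighboursExceptᵇ-sound v u covers-v

SmallCutConnected : ℕ → Set
SmallCutConnected n = ∀ (L : List (Vertex n)) → (∀ q → countParity q L < n) → ¬ IsolatesEdge L → Connected L

OneClassCutConnected : ℕ → Set
OneClassCutConnected n = ∀ q (L : List (Vertex n)) → All (λ v → hasParity q v ≡ true) L → length L ≤ n →
  ∀ x y → x ∉ L → y ∉ L → HasAliveNeighbour L x → HasAliveNeighbour L y → Reach (Alive L) x y

aliveᵇ : List (Vertex n) → Vertex n → Bool
aliveᵇ L v = not (does (v ∈ᵛ? L))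

aliveᵇ⇒∉ : (L : List (Vertex n)) → ∀ v → T (aliveᵇ L v) → v ∉ L
aliveᵇ⇒∉ L v h with v ∈ᵛ? L
... | no v∉L = v∉L

∉⇒aliveᵇ : (L : List (Vertex n)) → ∀ v → v ∉ L → T (aliveᵇ L v)
∉⇒aliveᵇ L v v∉L with v ∈ᵛ? L
... | yes v∈L = v∉L v∈L
... | no _    = _

¬aliveᵇ⇒∈ : (L : List (Vertex n)) → ∀ v → ¬ T (aliveᵇ L v) → v ∈ L
¬aliveᵇ⇒∈ L v ¬alive with v ∈ᵛ? L
... | yes v∈L = v∈L
... | no v∉L  = ⊥-elim (¬alive _)

countᵇ-removed≤ : ∀ f (L : List (Vertex n)) → countᵇ (λ v → f v ∧ not (aliveᵇ L v)) (vertices n) ≤ countᵇ f L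
countᵇ-removed≤ {n} f L = begin
  countᵇ removed (vertices n)            ≡⟨ length-filterᵇ removed (vertices n) ⟨
  length (filterᵇ removed (vertices n))  ≤⟨ Unique⇒length≤countᵇ f _ L (Unique.filter⁺ (T? ∘ removed) (vertices-unique n))
                                              (All.tabulate in-L) ⟩
  countᵇ f L                             ∎
  where
  open ≤-Reasoning
  removed : Vertex n → Bool
  removed v = f v ∧ not (aliveᵇ L v)
  in-L : ∀ {v} → v ∈ filterᵇ removed (vertices n) → v ∈ L × f v ≡ true
  in-L {v} v∈ with Equivalence.to T-∧ (proj₂ (∈-filter⁻ (T? ∘ removed) {xs = vertices n} v∈))
  ... | fv , not-alive = ¬aliveᵇ⇒∈ L v (T-not⇒¬T not-alive) , Equivalence.to T-≡ fv

-- A subset of the vertices of Q₃ is encoded by the eight bits of its indicator function.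
pattern-of : (Vertex 3 → Bool) → Vertex 8
pattern-of f = f (false ∷ false ∷ false ∷ []) ∷ f (false ∷ false ∷ true ∷ []) ∷
               f (false ∷ true ∷ false ∷ []) ∷ f (false ∷ true ∷ true ∷ []) ∷
               f (true ∷ false ∷ false ∷ []) ∷ f (true ∷ false ∷ true ∷ []) ∷
               f (true ∷ true ∷ false ∷ []) ∷ f (true ∷ true ∷ true ∷ []) ∷ []

indicator : Vertex 8 → Vertex 3 → Bool
indicator (b₀ ∷ b₁ ∷ b₂ ∷ b₃ ∷ b₄ ∷ b₅ ∷ b₆ ∷ b₇ ∷ []) (false ∷ false ∷ false ∷ []) = b₀
indicator (b₀ ∷ b₁ ∷ b₂ ∷ b₃ ∷ b₄ ∷ b₅ ∷ b₆ ∷ b₇ ∷ []) (false ∷ false ∷ true ∷ [])  = b₁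
indicator (b₀ ∷ b₁ ∷ b₂ ∷ b₃ ∷ b₄ ∷ b₅ ∷ b₆ ∷ b₇ ∷ []) (false ∷ true ∷ false ∷ [])  = b₂
indicator (b₀ ∷ b₁ ∷ b₂ ∷ b₃ ∷ b₄ ∷ b₅ ∷ b₆ ∷ b₇ ∷ []) (false ∷ true ∷ true ∷ [])   = b₃
indicator (b₀ ∷ b₁ ∷ b₂ ∷ b₃ ∷ b₄ ∷ b₅ ∷ b₆ ∷ b₇ ∷ []) (true ∷ false ∷ false ∷ [])  = b₄
indicator (b₀ ∷ b₁ ∷ b₂ ∷ b₃ ∷ b₄ ∷ b₅ ∷ b₆ ∷ b₇ ∷ []) (true ∷ false ∷ true ∷ [])   = b₅
indicator (b₀ ∷ b₁ ∷ b₂ ∷ b₃ ∷ b₄ ∷ b₅ ∷ b₆ ∷ b₇ ∷ []) (true ∷ true ∷ false ∷ [])   = b₆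
indicator (b₀ ∷ b₁ ∷ b₂ ∷ b₃ ∷ b₄ ∷ b₅ ∷ b₆ ∷ b₇ ∷ []) (true ∷ true ∷ true ∷ [])    = b₇

indicator-pattern-of : ∀ f v → indicator (pattern-of f) v ≡ f v
indicator-pattern-of f (false ∷ false ∷ false ∷ []) = refl
indicator-pattern-of f (false ∷ false ∷ true ∷ [])  = refl
indicator-pattern-of f (false ∷ true ∷ false ∷ [])  = refl
indicator-pattern-of f (false ∷ true ∷ true ∷ [])   = refl
indicator-pattern-of f (true ∷ false ∷ false ∷ [])  = refl
indicator-pattern-of f (true ∷ false ∷ true ∷ [])   = refl
indicator-pattern-of f (true ∷ true ∷ false ∷ [])   = refl
indicator-pattern-of f (true ∷ true ∷ true ∷ [])    = refl

module _ (p : Vertex 8) where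
  open Search (indicator p)

  removedOfParity : Bool → ℕ
  removedOfParity q = countᵇ (λ v → hasParity q v ∧ not (indicator p v)) (vertices 3)

  smallCutᵇ : Bool
  smallCutᵇ = (removedOfParity true ≤ᵇ 2) ∧ (removedOfParity false ≤ᵇ 2)

  smallCutConnectedᵇ : Bool
  smallCutConnectedᵇ = not smallCutᵇ ∨ (connectedᵇ (indicator p) ∨ isolatesEdgeᵇ)

  oneClassCutᵇ : Bool → Bool
  oneClassCutᵇ q = all (λ v → indicator p v ∨ hasParity q v) (vertices 3) ∧
                   (countᵇ (not ∘ indicator p) (vertices 3) ≤ᵇ 3)

  oneClassCutConnectedᵇ : Bool → Bool
  oneClassCutConnectedᵇ q =
    not (oneClassCutᵇ q) ∨ connectedᵇ (λ x → indicator p x ∧ hasAliveNeighbourᵇ x)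

-- Evaluated over all 2⁸ subsets of the vertices of Q₃.
smallCutConnectedᵇ-all : T (all smallCutConnectedᵇ (vertices 8))
smallCutConnectedᵇ-all = _

oneClassCutConnectedᵇ-all : ∀ q → T (all (λ p → oneClassCutConnectedᵇ p q) (vertices 8))
oneClassCutConnectedᵇ-all true  = _
oneClassCutConnectedᵇ-all false = _

smallCut⇒connectedᵇ-or-isolatesEdgeᵇ : ∀ p → T (smallCutᵇ p) →
  T (Search.connectedᵇ (indicator p) (indicator p) ∨ Search.isolatesEdgeᵇ (indicator p))
smallCut⇒connectedᵇ-or-isolatesEdgeᵇ p = ⇒ᵇ-elim (all-vertices⇒ smallCutConnectedᵇ smallCutConnectedᵇ-all p)

oneClassCut⇒connectedᵇ : ∀ p q → T (oneClassCutᵇ p q) →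
  T (Search.connectedᵇ (indicator p) (λ x → indicator p x ∧ Search.hasAliveNeighbourᵇ (indicator p) x))
oneClassCut⇒connectedᵇ p q = ⇒ᵇ-elim (all-vertices⇒ (λ p → oneClassCutConnectedᵇ p q) (oneClassCutConnectedᵇ-all q) p)

module BaseCase (L : List (Vertex 3)) where

  p : Vertex 8
  p = pattern-of (aliveᵇ L)

  open Search (indicator p)

  indicator≡aliveᵇ : ∀ v → indicator p v ≡ aliveᵇ L v
  indicator≡aliveᵇ = indicator-pattern-of (aliveᵇ L)

  Aliveᵇ⇒∉ : ∀ v → Aliveᵇ v → v ∉ L
  Aliveᵇ⇒∉ v h = aliveᵇ⇒∉ L v (subst T (indicator≡aliveᵇ v) h)

  ∉⇒Aliveᵇ : ∀ v → v ∉ L → Aliveᵇ v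
  ∉⇒Aliveᵇ v v∉L = subst T (sym (indicator≡aliveᵇ v)) (∉⇒aliveᵇ L v v∉L)

  ¬Aliveᵇ⇒∈ : ∀ v → ¬ Aliveᵇ v → v ∈ L
  ¬Aliveᵇ⇒∈ v ¬alive = ¬aliveᵇ⇒∈ L v (¬alive ∘ subst T (sym (indicator≡aliveᵇ v)))

  countᵇ-removed≤′ : ∀ f → countᵇ (λ v → f v ∧ not (indicator p v)) (vertices 3) ≤ countᵇ f L
  countᵇ-removed≤′ f = subst (_≤ countᵇ f L)
    (countᵇ-cong _ _ (vertices 3) (λ v → cong (λ b → f v ∧ not b) (sym (indicator≡aliveᵇ v))))
    (countᵇ-removed≤ f L)

  Reach-Aliveᵇ⇒Alive : ∀ {x y} → Reach Aliveᵇ x y → Reach (Alive L) x y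
  Reach-Aliveᵇ⇒Alive = Reach-mono Aliveᵇ⇒∉

  smallCut : (∀ q → countParity q L < 3) → T (smallCutᵇ p)
  smallCut count<3 = T-∧-intro (≤⇒≤ᵇ (≤-trans (countᵇ-removed≤′ (hasParity true)) (s≤s⁻¹ (count<3 true))))
                               (≤⇒≤ᵇ (≤-trans (countᵇ-removed≤′ (hasParity false)) (s≤s⁻¹ (count<3 false))))

  oneClassCut : ∀ q → All (λ v → hasParity q v ≡ true) L → length L ≤ 3 → T (oneClassCutᵇ p q)
  oneClassCut q L-parity |L|≤3 =
    T-∧-intro (all⁻ (λ v → indicator p v ∨ hasParity q v) (All.tabulate {xs = vertices 3} (λ {v} _ → covered v)))
              (≤⇒≤ᵇ few-removed)
    where
    covered : ∀ v → T (indicator p v ∨ hasParity q v)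
    covered v with v ∈ᵛ? L
    ... | yes v∈L = Equivalence.from T-∨ (inj₂ (Equivalence.from T-≡ (All.lookup L-parity v∈L)))
    ... | no v∉L  = Equivalence.from T-∨ (inj₁ (∉⇒Aliveᵇ v v∉L))
    few-removed : countᵇ (not ∘ indicator p) (vertices 3) ≤ 3
    few-removed = ≤-trans (countᵇ-removed≤′ (λ _ → true)) (≤-trans (countᵇ≤length _ L) |L|≤3)

  hasAliveNeighbour : ∀ x → HasAliveNeighbour L x → T (hasAliveNeighbourᵇ x)
  hasAliveNeighbour x (z , xz , z∉L) =
    any⁺ (λ z → adjacentᵇ x z ∧ indicator p z)
      (Any.map (λ { refl → T-∧-intro (Adj⇒adjacentᵇ x z xz) (∉⇒Aliveᵇ z z∉L) }) (∈-vertices z))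

  ¬IsolatesEdge⇒¬isolatesEdgeᵇ : ¬ IsolatesEdge L → ¬ T isolatesEdgeᵇ
  ¬IsolatesEdge⇒¬isolatesEdgeᵇ ¬isolates isolates =
    let (u , v , uv , alive-u , alive-v , covers-u , covers-v) = isolatesEdgeᵇ-sound isolates in
    ¬isolates (u , v , uv , Aliveᵇ⇒∉ u alive-u , Aliveᵇ⇒∉ v alive-v ,
               (λ w uw w≢v → ¬Aliveᵇ⇒∈ w (covers-u w uw w≢v)) , (λ w vw w≢u → ¬Aliveᵇ⇒∈ w (covers-v w vw w≢u)))

smallCutConnected-3 : SmallCutConnected 3
smallCutConnected-3 L count<3 ¬isolates x y x∉L y∉L =
  [ (λ connected → Reach-Aliveᵇ⇒Alive
                     (connectedᵇ-sound (indicator p) connected x y (∉⇒Aliveᵇ x x∉L) (∉⇒Aliveᵇ y y∉L)))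
  , (λ isolates → ⊥-elim (¬IsolatesEdge⇒¬isolatesEdgeᵇ ¬isolates isolates)) ]′
  (Equivalence.to T-∨ (smallCut⇒connectedᵇ-or-isolatesEdgeᵇ p (smallCut count<3)))
  where
  open BaseCase L
  open Search (indicator p)

oneClassCutConnected-3 : OneClassCutConnected 3
oneClassCutConnected-3 q L L-parity |L|≤3 x y x∉L y∉L x-neighbour y-neighbour =
  Reach-Aliveᵇ⇒Alive (connectedᵇ-sound (λ x → indicator p x ∧ hasAliveNeighbourᵇ x)
    (oneClassCut⇒connectedᵇ p q (oneClassCut q L-parity |L|≤3)) x y
    (T-∧-intro (∉⇒Aliveᵇ x x∉L) (hasAliveNeighbour x x-neighbour))
    (T-∧-intro (∉⇒Aliveᵇ y y∉L) (hasAliveNeighbour y y-neighbour)))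
  where
  open BaseCase L
  open Search (indicator p)

-- Induction on the dimension

suc-n<2^n : 2 ≤ n → suc n < 2 ^ n
suc-n<2^n {suc zero}          (s≤s ())
suc-n<2^n {suc (suc zero)}    _ = s≤s (s≤s (s≤s (s≤s z≤n)))
suc-n<2^n {suc (suc (suc n))} _ = begin-strict
  suc (suc (suc (suc n)))    <⟨ s≤s (suc-n<2^n {suc (suc n)} (s≤s (s≤s z≤n))) ⟩
  suc (2 ^ suc (suc n))      ≤⟨ +-monoˡ-≤ (2 ^ suc (suc n)) (m^n>0 2 (suc (suc n))) ⟩
  2 ^ suc (suc n) + 2 ^ suc (suc n)        ≡⟨ cong (2 ^ suc (suc n) +_) (sym (+-identityʳ _)) ⟩
  2 ^ suc (suc (suc n))      ∎
  where open ≤-Reasoning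

n+n<2^n : 3 ≤ n → n + n < 2 ^ n
n+n<2^n {suc n} (s≤s 2≤n) =
  subst (suc n + suc n <_) (cong (2 ^ n +_) (sym (+-identityʳ _))) (+-mono-< (suc-n<2^n 2≤n) (suc-n<2^n 2≤n))

vertex-of-parity-outside : 2 ≤ n → ∀ q (M : List (Vertex (suc n))) → length M ≤ suc n →
                           Σ (Vertex (suc n)) λ t → hasParity q t ≡ true × t ∉ M
vertex-of-parity-outside {n} 2≤n q M |M|≤ with pigeonhole _≟ᵛ_ (filterᵇ (hasParity q) (vertices (suc n))) M
  (Unique.filter⁺ (T? ∘ hasParity q) (vertices-unique (suc n)))
  (≤-<-trans |M|≤ (subst (suc n <_) (sym (trans (length-filterᵇ (hasParity q) (vertices (suc n))) (countParity-vertices n q)))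
    (suc-n<2^n 2≤n)))
... | t , t∈ , t∉M = t , Equivalence.to T-≡ (proj₂ (∈-filter⁻ (T? ∘ hasParity q) {xs = vertices (suc n)} t∈)) , t∉M

some-neighbour : 1 ≤ n → (t : Vertex n) → Σ (Vertex n) λ z → Adj t z
some-neighbour {suc n} _ t = flip zero t , Adj-flip zero t

-- Both copies of the hub t avoid L (c ∷ t by parity, not c ∷ t by the choice of t), and each half
-- is connected through them by the induction hypothesis.
module OneClassStep (n : ℕ) (1≤n : 1 ≤ n) (ih : OneClassCutConnected n) (q : Bool) (L : List (Vertex (suc n)))
  (L-parity : All (λ v → hasParity q v ≡ true) L) (|half|≤n : ∀ b → length (half b L) ≤ n)
  (c : Bool) (|half-c|<n : length (half c L) < n)
  (t : Vertex n) (t-parity : hasParity (not c xor q) t ≡ true) (t∉ : t ∉ half (not c) L) where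

  neighbour-of : (s : Vertex n) → Σ (Vertex n) λ z → Adj s z
  neighbour-of = some-neighbour 1≤n

  t∉half : ∀ b → t ∉ half b L
  t∉half b t∈ with b ≟ᵇ c
  ... | yes refl = hasParity-contra (c xor q) t (All.lookup (half-parity q c L L-parity) t∈)
                     (subst (λ r → hasParity r t ≡ true) (sym (not-distribˡ-xor c q)) t-parity)
  ... | no b≢c   = t∉ (subst (λ b → t ∈ half b L) (¬-not b≢c) t∈)

  t-neighbour : ∀ b → HasAliveNeighbour (half b L) t
  t-neighbour b with b ≟ᵇ c
  ... | yes refl = length<⇒HasAliveNeighbour (half c L) |half-c|<n t
  ... | no b≢c   = let (z , tz) = neighbour-of t in
    z , tz , λ z∈ → hasParity-contra (not c xor q) z (subst (λ b → hasParity (b xor q) z ≡ true) (¬-not b≢c)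
                      (All.lookup (half-parity q b L L-parity) z∈))
                      (Adj⇒hasParity-not (not c xor q) {t} {z} tz t-parity)

  reach-hub-in-half : ∀ b s → s ∉ half b L → HasAliveNeighbour (half b L) s → Reach (Alive L) (b ∷ s) (c ∷ t)
  reach-hub-in-half b s s∉ s-neighbour =
    Reach-trans (Reach-half b L (ih (b xor q) (half b L) (half-parity q b L L-parity) (|half|≤n b)
                   s t s∉ (t∉half b) s-neighbour (t-neighbour b)))
                (Reach-across L b c t (t∉half c ∘ ∈-half⁺ c L))

  reach-hub : ∀ x → x ∉ L → HasAliveNeighbour L x → Reach (Alive L) x (c ∷ t)
  reach-hub (a ∷ s) a∷s∉L (b ∷ s′ , x-s′ , b∷s′∉L) with hasAliveNeighbour? (half a L) s
  ... | yes s-neighbour = reach-hub-in-half a s (a∷s∉L ∘ ∈-half⁻ a L) s-neighbour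
  ... | no ¬s-neighbour with Adj-cons⁻ a b s s′ x-s′
  ...   | inj₁ (refl , ss′) = ⊥-elim (¬s-neighbour (s′ , ss′ , b∷s′∉L ∘ ∈-half⁻ a L))
  ...   | inj₂ (refl , refl) =
    step x-s′ b∷s′∉L (reach-hub-in-half (not a) s (b∷s′∉L ∘ ∈-half⁻ (not a) L) mate-neighbour)
    where
    -- The neighbours of s in half a are all removed, so they have parity a xor q and survive in half (not a).
    mate-neighbour : HasAliveNeighbour (half (not a) L) s
    mate-neighbour = let (z , sz) = neighbour-of s in
      z , sz , λ z∈ → hasParity-contra (a xor q) z
        (All.lookup (half-parity q a L L-parity) (¬HasAliveNeighbour⇒ (half a L) s ¬s-neighbour z sz))
        (subst (λ r → hasParity r z ≡ true) (sym (not-distribˡ-xor a q))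
               (All.lookup (half-parity q (not a) L L-parity) z∈))

  connected : ∀ x y → x ∉ L → y ∉ L → HasAliveNeighbour L x → HasAliveNeighbour L y → Reach (Alive L) x y
  connected x y x∉L y∉L x-neighbour y-neighbour =
    Reach-trans (reach-hub x x∉L x-neighbour) (Reach-sym y∉L (reach-hub y y∉L y-neighbour))

half-length≡0 : ∀ c (L : List (Vertex (suc n))) → length (half c L) ≡ 0 → ∀ t → (c ∷ t) ∉ L
half-length≡0 c L |half|≡0 t c∷t∈L with half c L | ∈-half⁺ c L c∷t∈L
... | _ ∷ _ | _ with |half|≡0
...   | ()

a+b≤n≤a⇒b≡0 : ∀ {a b} → a + b ≤ n → n ≤ a → b ≡ 0
a+b≤n≤a⇒b≡0 {n} {a} a+b≤n n≤a = n≤0⇒n≡0 (+-cancelˡ-≤ a _ _ (≤-trans a+b≤n (subst (n ≤_) (sym (+-identityʳ a)) n≤a)))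

a+b≤n≤1+a⇒b≤1 : ∀ {a b} → a + b ≤ n → n ≤ suc a → b ≤ 1
a+b≤n≤1+a⇒b≤1 {n} {a} a+b≤n n≤1+a = +-cancelˡ-≤ a _ _ (≤-trans a+b≤n (subst (n ≤_) (+-comm 1 a) n≤1+a))

oneClassCutConnected-suc : ∀ m → 2 ≤ m → OneClassCutConnected (suc m) → OneClassCutConnected (suc (suc m))
oneClassCutConnected-suc m 2≤m ih q L L-parity |L|≤ x y x∉L y∉L x-neighbour y-neighbour
  with length (half false L) ≤? suc m | length (half true L) ≤? suc m
... | no big₀ | _ = half-empty⇒Connected L true (half-length≡0 true L
        (a+b≤n≤a⇒b≡0 (subst (_≤ suc (suc m)) (length-halves L) |L|≤) (≰⇒> big₀))) x y x∉L y∉L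
... | yes _ | no big₁ = half-empty⇒Connected L false (half-length≡0 false L
        (a+b≤n≤a⇒b≡0 (subst (_≤ suc (suc m)) (trans (length-halves L) (+-comm (length (half false L)) _)) |L|≤)
          (≰⇒> big₁))) x y x∉L y∉L
... | yes ≤₀ | yes ≤₁ = OneClassStep.connected (suc m) (s≤s z≤n) ih q L L-parity |half|≤ c |half-c|<
                          t t-parity t∉ x y x∉L y∉L x-neighbour y-neighbour
  where
  |half|≤ : ∀ b → length (half b L) ≤ suc m
  |half|≤ false = ≤₀
  |half|≤ true  = ≤₁
  small-half : Σ Bool λ c → length (half c L) < suc m
  small-half with length (half false L) <? suc m
  ... | yes <₀ = false , <₀
  ... | no ≮₀  = true , ≤-<-trans (a+b≤n≤1+a⇒b≤1 (subst (_≤ suc (suc m)) (length-halves L) |L|≤) (s≤s (≮⇒≥ ≮₀)))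
                                  (s≤s (≤-trans (s≤s z≤n) 2≤m))
  c : Bool
  c = proj₁ small-half
  |half-c|< : length (half c L) < suc m
  |half-c|< = proj₂ small-half
  outside : Σ (Vertex (suc m)) λ t → hasParity (not c xor q) t ≡ true × t ∉ half (not c) L
  outside = vertex-of-parity-outside 2≤m (not c xor q) (half (not c) L) (|half|≤ (not c))
  t : Vertex (suc m)
  t = proj₁ outside
  t-parity : hasParity (not c xor q) t ≡ true
  t-parity = proj₁ (proj₂ outside)
  t∉ : t ∉ half (not c) L
  t∉ = proj₂ (proj₂ outside)

oneClassCutConnected : ∀ n → 3 ≤ n → OneClassCutConnected n
oneClassCutConnected (suc zero)                (s≤s ())
oneClassCutConnected (suc (suc zero))          (s≤s (s≤s ()))
oneClassCutConnected (suc (suc (suc zero)))    _ = oneClassCutConnected-3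
oneClassCutConnected (suc (suc (suc (suc n)))) _ =
  oneClassCutConnected-suc (suc (suc n)) (s≤s (s≤s z≤n)) (oneClassCutConnected (suc (suc (suc n))) 3≤)
  where
  3≤ : 3 ≤ suc (suc (suc n))
  3≤ = s≤s (s≤s (s≤s z≤n))

ReachesHalf : List (Vertex (suc n)) → Bool → Vertex (suc n) → Set
ReachesHalf {n} L c x = Σ (Vertex n) λ s → (c ∷ s) ∉ L × Reach (Alive L) x (c ∷ s)

Connected-via-half : (L : List (Vertex (suc n))) → ∀ c → Connected (half c L) →
                     (∀ x → x ∉ L → ReachesHalf L c x) → Connected L
Connected-via-half L c half-connected reaches x y x∉L y∉L with reaches x x∉L | reaches y y∉L
... | s , c∷s∉L , x↝ | s′ , c∷s′∉L , y↝ =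
  Reach-trans x↝ (Reach-trans (Reach-half c L (half-connected s s′ (c∷s∉L ∘ ∈-half⁻ c L) (c∷s′∉L ∘ ∈-half⁻ c L)))
                              (Reach-sym y∉L y↝))

edge-reaches-half : (L : List (Vertex (suc n))) → ∀ c a (s : Vertex n) → (a ∷ s) ∉ L → (not a ∷ s) ∉ L →
                    ReachesHalf L c (a ∷ s)
edge-reaches-half L true  true  s a∷s∉L mate∉L = s , a∷s∉L , here
edge-reaches-half L false false s a∷s∉L mate∉L = s , a∷s∉L , here
edge-reaches-half L false true  s a∷s∉L mate∉L = s , mate∉L , Reach-single (Adj-not-cons true s) mate∉L
edge-reaches-half L true  false s a∷s∉L mate∉L = s , mate∉L , Reach-single (Adj-not-cons false s) mate∉L

countParity≡0⇒hasParity : ∀ q (M : List (Vertex n)) → countParity (not q) M ≡ 0 → ∀ {s} → s ∈ M → hasParity q s ≡ true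
countParity≡0⇒hasParity q M count≡0 {s} s∈M with hasParity-either q s
... | inj₁ q-s = q-s
... | inj₂ ¬q-s = ⊥-elim (countᵇ≡0⇒ (hasParity (not q)) M count≡0 s∈M ¬q-s)

module SmallCutStep (n : ℕ) (3≤n : 3 ≤ n) (ih : SmallCutConnected n) (ih₁ : OneClassCutConnected n)
  (L : List (Vertex (suc n))) (count< : ∀ q → countParity q L < suc n) (¬isolates : ¬ IsolatesEdge L) where

  counts-across : ∀ b q → countParity q (half b L) + countParity (not q) (half (not b) L) ≤ n
  counts-across false q = subst (_≤ n) (countParity-halves q L) (s≤s⁻¹ (count< q))
  counts-across true  q = subst (_≤ n)
    (trans (countParity-halves (not q) L)
           (trans (cong (λ r → countParity (not q) (half false L) + countParity r (half true L)) (not-involutive q))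
                  (+-comm (countParity (not q) (half false L)) _)))
    (s≤s⁻¹ (count< (not q)))

  half-not-not : ∀ b → half (not (not b)) L ≡ half b L
  half-not-not b = cong (λ b → half b L) (not-involutive b)

  module HalfSaturated (b q : Bool) (saturated : n ≤ countParity q (half b L)) where

    none-across : countParity (not q) (half (not b) L) ≡ 0
    none-across = a+b≤n≤a⇒b≡0 (counts-across b q) saturated

    across-parity : ∀ {s} → s ∈ half (not b) L → hasParity q s ≡ true
    across-parity = countParity≡0⇒hasParity q (half (not b) L) none-across

    -- Only vertices of parity q are removed from half (not b), so it is connected by the induction
    -- hypothesis; a vertex of half b whose mate is removed has a neighbour in half b with a live mate.
    other-unsaturated : countParity q (half (not b) L) < n → Connected L
    other-unsaturated count-q< = Connected-via-half L (not b) (ih (half (not b) L) counts ¬isolates′) reaches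
      where
      counts : ∀ r → countParity r (half (not b) L) < n
      counts r with r ≟ᵇ q
      ... | yes refl = count-q<
      ... | no r≢q   = subst (λ r → countParity r (half (not b) L) < n) (sym (¬-not r≢q))
                         (subst (_< n) (sym none-across) (≤-trans (s≤s z≤n) 3≤n))
      ¬isolates′ : ¬ IsolatesEdge (half (not b) L)
      ¬isolates′ isolates with ≤-trans 3≤n (subst (λ k → n ≤ suc k) none-across
                                 (IsolatesEdge⇒n≤1+countParity (half (not b) L) isolates (not q)))
      ... | s≤s ()
      reaches : ∀ x → x ∉ L → ReachesHalf L (not b) x
      reaches (a ∷ s) a∷s∉L with (not a ∷ s) ∈ᵛ? L | a ≟ᵇ b
      ... | _ | no a≢b = let ¬b∷s∉L = subst (λ a → (a ∷ s) ∉ L) (¬-not a≢b) a∷s∉L in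
        s , ¬b∷s∉L , Reach-across L a (not b) s ¬b∷s∉L
      ... | no mate∉L | yes refl = edge-reaches-half L (not b) b s a∷s∉L mate∉L
      ... | yes mate∈L | yes refl with countParity<⇒HasAliveNeighbour L (b ∷ s) (count< _)
      ...   | (c ∷ s′) , xz , z∉L with Adj-cons⁻ b c s s′ xz
      ...     | inj₂ (refl , refl) = ⊥-elim (z∉L mate∈L)
      ...     | inj₁ (refl , ss′)  = s′ , mate′∉L , step xz z∉L (Reach-single (Adj-not-cons b s′) mate′∉L)
        where
        mate′∉L : (not b ∷ s′) ∉ L
        mate′∉L mate′∈L = hasParity-contra q s′ (across-parity (∈-half⁺ (not b) L mate′∈L))
          (Adj⇒hasParity-not q {s} {s′} ss′ (across-parity (∈-half⁺ (not b) L mate∈L)))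

    -- Both halves only lose vertices of parity q. Then S, the positions removed in both halves,
    -- is a one-class set in Q_n, and walks avoiding S lift to Q_{n+1} − L by switching halves
    -- whenever the next vertex is removed: its mate is then alive, and so is the mate of the current vertex.
    both-saturated : n ≤ countParity q (half (not b) L) → Connected L
    both-saturated saturated′ (a ∷ s) (c ∷ s′) a∷s∉L c∷s′∉L =
      let (a′ , a′∷s′∉L , ↝) = lift (ih₁ q S S-parity |S|≤n s s′ (∉S a s a∷s∉L) (∉S c s′ c∷s′∉L)
                                   (S-neighbour a s a∷s∉L) (S-neighbour c s′ c∷s′∉L)) a a∷s∉L in
      Reach-trans ↝ (Reach-across L a′ c s′ c∷s′∉L)
      where
      none-here : countParity (not q) (half b L) ≡ 0
      none-here = a+b≤n≤a⇒b≡0 (subst (λ M → countParity q (half (not b) L) + countParity (not q) M ≤ n)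
                                 (half-not-not b) (counts-across (not b) q)) saturated′

      removed-parity : ∀ c {s} → s ∈ half c L → hasParity q s ≡ true
      removed-parity c s∈ with c ≟ᵇ b
      ... | yes refl = countParity≡0⇒hasParity q (half b L) none-here s∈
      ... | no c≢b   = across-parity (subst (λ c → _ ∈ half c L) (¬-not c≢b) s∈)

      ¬q⇒∉L : ∀ c s → hasParity (not q) s ≡ true → (c ∷ s) ∉ L
      ¬q⇒∉L c s ¬q-s c∷s∈L = hasParity-contra q s (removed-parity c (∈-half⁺ c L c∷s∈L)) ¬q-s

      S : List (Vertex n)
      S = filter (_∈ᵛ? half (not b) L) (half b L)

      ∈S⁻ : ∀ {s} → s ∈ S → s ∈ half b L × s ∈ half (not b) L
      ∈S⁻ = ∈-filter⁻ (_∈ᵛ? half (not b) L) {xs = half b L}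

      S-parity : All (λ v → hasParity q v ≡ true) S
      S-parity = All.tabulate (λ s∈ → removed-parity b (proj₁ (∈S⁻ s∈)))

      |S|≤n : length S ≤ n
      |S|≤n = begin
        length S                                                     ≤⟨ length-filter (_∈ᵛ? half (not b) L) (half b L) ⟩
        length (half b L)                                            ≡⟨ length≡countParity+countParity q (half b L) ⟩
        countParity q (half b L) + countParity (not q) (half b L)    ≡⟨ cong (countParity q (half b L) +_) none-here ⟩
        countParity q (half b L) + 0                                 ≤⟨ +-monoʳ-≤ (countParity q (half b L)) z≤n ⟩
        countParity q (half b L) + countParity (not q) (half (not b) L) ≤⟨ counts-across b q ⟩
        n                                                            ∎
        where open ≤-Reasoning

      ∈-both⇒∈S : ∀ a {s} → s ∈ half a L → s ∈ half (not a) L → s ∈ S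
      ∈-both⇒∈S a {s} s∈a s∈¬a with a ≟ᵇ b
      ... | yes refl = ∈-filter⁺ (_∈ᵛ? half (not b) L) s∈a s∈¬a
      ... | no a≢b   = ∈-filter⁺ (_∈ᵛ? half (not b) L)
                         (subst (λ c → s ∈ half c L) (trans (cong not (¬-not a≢b)) (not-involutive b)) s∈¬a)
                         (subst (λ a → s ∈ half a L) (¬-not a≢b) s∈a)

      ∉S : ∀ a s → (a ∷ s) ∉ L → s ∉ S
      ∉S a s a∷s∉L s∈S with ∈S⁻ s∈S | a ≟ᵇ b
      ... | s∈b , _   | yes refl = a∷s∉L (∈-half⁻ b L s∈b)
      ... | _   , s∈¬b | no a≢b  = a∷s∉L (∈-half⁻ a L (subst (λ a → s ∈ half a L) (sym (¬-not a≢b)) s∈¬b))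

      S-neighbour : ∀ a s → (a ∷ s) ∉ L → HasAliveNeighbour S s
      S-neighbour a s a∷s∉L with hasAliveNeighbour? S s
      ... | yes s-neighbour = s-neighbour
      ... | no ¬s-neighbour = ⊥-elim (¬isolates (b ∷ s , not b ∷ s , Adj-not-cons b s ,
              ¬q⇒∉L b s ¬q-s , ¬q⇒∉L (not b) s ¬q-s , covers-b , covers-¬b))
        where
        in-S : ∀ z → Adj s z → z ∈ S
        in-S = ¬HasAliveNeighbour⇒ S s ¬s-neighbour
        ¬q-s : hasParity (not q) s ≡ true
        ¬q-s = let (z , sz) = some-neighbour (≤-trans (s≤s z≤n) 3≤n) s in
               Adj⇒hasParity-not q {z} {s} (Adj-sym {x = s} {z} sz) (All.lookup S-parity (in-S z sz))
        covers-b : CoversNeighboursExcept L (b ∷ s) (not b ∷ s)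
        covers-b (c ∷ w) b∷s-w w≢ with Adj-cons⁻ b c s w b∷s-w
        ... | inj₁ (refl , sw) = ∈-half⁻ b L (proj₁ (∈S⁻ (in-S w sw)))
        ... | inj₂ (refl , refl) = ⊥-elim (w≢ refl)
        covers-¬b : CoversNeighboursExcept L (not b ∷ s) (b ∷ s)
        covers-¬b (c ∷ w) ¬b∷s-w w≢ with Adj-cons⁻ (not b) c s w ¬b∷s-w
        ... | inj₁ (refl , sw) = ∈-half⁻ (not b) L (proj₂ (∈S⁻ (in-S w sw)))
        ... | inj₂ (c≡ , refl) = ⊥-elim (w≢ (cong (_∷ s) (trans c≡ (not-involutive b))))

      lift : ∀ {s s′} → Reach (Alive S) s s′ → ∀ a → (a ∷ s) ∉ L →
             Σ Bool λ a′ → (a′ ∷ s′) ∉ L × Reach (Alive L) (a ∷ s) (a′ ∷ s′)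
      lift here a a∷s∉L = a , a∷s∉L , here
      lift (step {s} {w} sw w∉S rest) a a∷s∉L with (a ∷ w) ∈ᵛ? L
      ... | no a∷w∉L = let (a′ , end∉L , ↝) = lift rest a a∷w∉L in
                       a′ , end∉L , step (Adj-cons a {s} {w} sw) a∷w∉L ↝
      ... | yes a∷w∈L = let (a′ , end∉L , ↝) = lift rest (not a) ¬a∷w∉L in
                        a′ , end∉L , step (Adj-not-cons a s) ¬a∷s∉L (step (Adj-cons (not a) {s} {w} sw) ¬a∷w∉L ↝)
        where
        ¬a∷s∉L : (not a ∷ s) ∉ L
        ¬a∷s∉L = ¬q⇒∉L (not a) s (Adj⇒hasParity-not q {w} {s} (Adj-sym {x = s} {w} sw)
                                   (removed-parity a (∈-half⁺ a L a∷w∈L)))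
        ¬a∷w∉L : (not a ∷ w) ∉ L
        ¬a∷w∉L ¬a∷w∈L = w∉S (∈-both⇒∈S a (∈-half⁺ a L a∷w∈L) (∈-half⁺ (not a) L ¬a∷w∈L))

  module BalancedHalves (balanced : ∀ b q → countParity q (half b L) < n) where

    Heavy : Bool → Set
    Heavy b = ∀ q → n ≤ suc (countParity q (half b L))

    heavy? : ∀ b → Dec (Heavy b)
    heavy? b with n ≤? suc (countParity true (half b L)) | n ≤? suc (countParity false (half b L))
    ... | yes heavy-t | yes heavy-f = yes λ { true → heavy-t ; false → heavy-f }
    ... | no ¬heavy-t | _           = no λ heavy → ¬heavy-t (heavy true)
    ... | yes _       | no ¬heavy-f = no λ heavy → ¬heavy-f (heavy false)

    light⇒Connected : ∀ b → ¬ Heavy b → Connected (half b L)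
    light⇒Connected b light = ih (half b L) (balanced b) (light ∘ IsolatesEdge⇒n≤1+countParity (half b L))

    -- A position t free in both halves is a hub: both halves are connected and the copies of t are adjacent.
    both-light : ¬ Heavy false → ¬ Heavy true → Connected L
    both-light light₀ light₁ x y x∉L y∉L = Reach-trans (reach-hub x x∉L) (Reach-sym y∉L (reach-hub y y∉L))
      where
      |halves|<2^n : length (half false L ++ half true L) < length (vertices n)
      |halves|<2^n = begin-strict
        length (half false L ++ half true L)          ≡⟨ length-++ (half false L) ⟩
        length (half false L) + length (half true L)  ≡⟨ length-halves L ⟨
        length L                                      ≡⟨ length≡countParity+countParity true L ⟩
        countParity true L + countParity false L      ≤⟨ +-mono-≤ (s≤s⁻¹ (count< true)) (s≤s⁻¹ (count< false)) ⟩
        n + n                                         <⟨ n+n<2^n 3≤n ⟩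
        2 ^ n                                         ≡⟨ length-vertices n ⟨
        length (vertices n)                           ∎
        where open ≤-Reasoning
      hub : Σ (Vertex n) λ t → t ∈ vertices n × t ∉ half false L ++ half true L
      hub = pigeonhole _≟ᵛ_ (vertices n) (half false L ++ half true L) (vertices-unique n) |halves|<2^n
      t : Vertex n
      t = proj₁ hub
      t∉half : ∀ a → t ∉ half a L
      t∉half false = proj₂ (proj₂ hub) ∘ ∈-++⁺ˡ
      t∉half true  = proj₂ (proj₂ hub) ∘ ∈-++⁺ʳ (half false L)
      light : ∀ a → ¬ Heavy a
      light false = light₀
      light true  = light₁
      reach-hub : ∀ x → x ∉ L → Reach (Alive L) x (false ∷ t)
      reach-hub (a ∷ s) a∷s∉L =
        Reach-trans (Reach-half a L (light⇒Connected a (light a) s t (a∷s∉L ∘ ∈-half⁻ a L) (t∉half a)))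
                    (Reach-across L a false t (t∉half false ∘ ∈-half⁺ false L))

    mate : Vertex (suc n) → Vertex (suc n)
    mate (a ∷ t) = not a ∷ t

    Good : Vertex (suc n) → Set
    Good z = z ∉ L × mate z ∉ L

    good? : ∀ z → Dec (Good z)
    good? z = ¬? (z ∈ᵛ? L) ×-dec ¬? (mate z ∈ᵛ? L)

    -- The other half is connected since it is very sparse. A vertex whose mate is removed has a live
    -- neighbour, and unless this leads to a live edge between the halves within two steps, the two
    -- vertices form an isolated edge: at most one vertex of each parity is removed from the other half.
    one-heavy : ∀ b → Heavy b → Connected L
    one-heavy b heavy = Connected-via-half L (not b) (light⇒Connected (not b) light) reaches
      where
      sparse : ∀ q → countParity q (half (not b) L) ≤ 1
      sparse q = subst (λ r → countParity r (half (not b) L) ≤ 1) (not-involutive q)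
                   (a+b≤n≤1+a⇒b≤1 (counts-across b (not q)) (heavy (not q)))

      light : ¬ Heavy (not b)
      light heavy′ with ≤-trans 3≤n (≤-trans (heavy′ true) (s≤s (sparse true)))
      ... | s≤s (s≤s ())

      good⇒reaches : ∀ z → Good z → ReachesHalf L (not b) z
      good⇒reaches (c ∷ t) (z∉L , mate∉L) = edge-reaches-half L (not b) c t z∉L mate∉L

      covers : ∀ s s′ → Adj s s′ → (not b ∷ s) ∈ L → (not b ∷ s′) ∈ L → ¬ Any Good (neighbours (b ∷ s)) →
               CoversNeighboursExcept L (b ∷ s) (b ∷ s′)
      covers s s′ ss′ mate∈L mate′∈L none (c ∷ w) x-w w≢ with (c ∷ w) ∈ᵛ? L
      ... | yes w∈L = w∈L
      ... | no w∉L with Adj-cons⁻ b c s w x-w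
      ...   | inj₂ (refl , refl) = ⊥-elim (w∉L mate∈L)
      ...   | inj₁ (refl , sw) with (not b ∷ w) ∈ᵛ? L
      ...     | no mate-w∉L = ⊥-elim (none (lose (Adj⇒∈-neighbours (b ∷ s) (b ∷ w) x-w) (w∉L , mate-w∉L)))
      ...     | yes mate-w∈L = ⊥-elim (w≢ (cong (b ∷_)
                  (countᵇ≤1⇒≡ _≟ᵛ_ (hasParity (not (parity s))) (half (not b) L) (sparse _)
                    (∈-half⁺ (not b) L mate-w∈L) (∈-half⁺ (not b) L mate′∈L)
                    (Adj⇒hasParity-not (parity s) {s} {w} sw (hasParity-parity s))
                    (Adj⇒hasParity-not (parity s) {s} {s′} ss′ (hasParity-parity s)))))

      reaches : ∀ x → x ∉ L → ReachesHalf L (not b) x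
      reaches (a ∷ s) a∷s∉L with a ≟ᵇ b | (not a ∷ s) ∈ᵛ? L
      ... | no a≢b   | _         = let ¬b∷s∉L = subst (λ a → (a ∷ s) ∉ L) (¬-not a≢b) a∷s∉L in
                                   s , ¬b∷s∉L , Reach-across L a (not b) s ¬b∷s∉L
      ... | yes refl | no mate∉L = edge-reaches-half L (not b) b s a∷s∉L mate∉L
      ... | yes refl | yes mate∈L with any? good? (neighbours (b ∷ s))
      ...   | yes found = let (z , z∈ , z-good) = find found
                              (t , t∉L , ↝) = good⇒reaches z z-good in
                          t , t∉L , step (∈-neighbours⇒Adj (b ∷ s) z∈) (proj₁ z-good) ↝
      ...   | no none with countParity<⇒HasAliveNeighbour L (b ∷ s) (count< _)
      ...     | (c₀ ∷ s₀) , x-z , z∉L with Adj-cons⁻ b c₀ s s₀ x-z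
      ...       | inj₂ (refl , refl) = ⊥-elim (z∉L mate∈L)
      ...       | inj₁ (refl , ss₀) with (not b ∷ s₀) ∈ᵛ? L
      ...         | no mate₀∉L = ⊥-elim (none (lose (Adj⇒∈-neighbours (b ∷ s) (b ∷ s₀) x-z) (z∉L , mate₀∉L)))
      ...         | yes mate₀∈L with any? good? (neighbours (b ∷ s₀))
      ...           | yes found = let (z , z∈ , z-good) = find found
                                      (t , t∉L , ↝) = good⇒reaches z z-good in
                                  t , t∉L , step x-z z∉L (step (∈-neighbours⇒Adj (b ∷ s₀) z∈) (proj₁ z-good) ↝)
      ...           | no none₀ = ⊥-elim (¬isolates (b ∷ s , b ∷ s₀ , x-z , a∷s∉L , z∉L ,
                                   covers s s₀ ss₀ mate∈L mate₀∈L none ,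
                                   covers s₀ s (Adj-sym {x = s} {s₀} ss₀) mate₀∈L mate∈L none₀))

    connected : Connected L
    connected with heavy? false | heavy? true
    ... | yes heavy | _         = one-heavy false heavy
    ... | no _      | yes heavy = one-heavy true heavy
    ... | no light₀ | no light₁ = both-light light₀ light₁

  saturated-or-balanced : (Σ Bool λ b → Σ Bool λ q → n ≤ countParity q (half b L)) ⊎
                          (∀ b q → countParity q (half b L) < n)
  saturated-or-balanced with countParity true (half false L) <? n | countParity false (half false L) <? n
                           | countParity true (half true L) <? n  | countParity false (half true L) <? n
  ... | no ≮ | _ | _ | _ = inj₁ (false , true , ≮⇒≥ ≮)
  ... | _ | no ≮ | _ | _ = inj₁ (false , false , ≮⇒≥ ≮)
  ... | _ | _ | no ≮ | _ = inj₁ (true , true , ≮⇒≥ ≮)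
  ... | _ | _ | _ | no ≮ = inj₁ (true , false , ≮⇒≥ ≮)
  ... | yes <₁ | yes <₂ | yes <₃ | yes <₄ =
    inj₂ λ { false true → <₁ ; false false → <₂ ; true true → <₃ ; true false → <₄ }

  connected : Connected L
  connected with saturated-or-balanced
  ... | inj₂ balanced = BalancedHalves.connected balanced
  ... | inj₁ (b , q , saturated) with countParity q (half (not b) L) <? n
  ...   | yes unsaturated = HalfSaturated.other-unsaturated b q saturated unsaturated
  ...   | no ≮            = HalfSaturated.both-saturated b q saturated (≮⇒≥ ≮)

smallCutConnected : ∀ n → 3 ≤ n → SmallCutConnected n
smallCutConnected (suc zero)                (s≤s ())
smallCutConnected (suc (suc zero))          (s≤s (s≤s ()))
smallCutConnected (suc (suc (suc zero)))    _ = smallCutConnected-3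
smallCutConnected (suc (suc (suc (suc n)))) _ L count< ¬isolates =
  SmallCutStep.connected (suc (suc (suc n))) 3≤ (smallCutConnected (suc (suc (suc n))) 3≤)
    (oneClassCutConnected (suc (suc (suc n))) 3≤) L count< ¬isolates
  where
  3≤ : 3 ≤ suc (suc (suc n))
  3≤ = s≤s (s≤s (s≤s z≤n))

-- Families of short paths

Alternates : Bool → List (Vertex n) → Set
Alternates q xs = countParity q xs ≡ countParity (not q) xs ⊎ countParity q xs ≡ suc (countParity (not q) xs)

Linked⇒Alternates : ∀ q (x : Vertex n) xs → Linked Adj (x ∷ xs) → hasParity q x ≡ true → Alternates q (x ∷ xs)
Linked⇒Alternates q x []       [-]          q-x rewrite q-x | hasParity⇒not-false q x q-x = inj₂ refl
Linked⇒Alternates q x (y ∷ ys) (xy ∷ linked) q-x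
  with Linked⇒Alternates (not q) y ys linked (Adj⇒hasParity-not q {x} {y} xy q-x)
... | alternates rewrite not-involutive q | q-x | hasParity⇒not-false q x q-x | Adj⇒hasParity-not q {x} {y} xy q-x
                       | hasParity-not⇒false q y (Adj⇒hasParity-not q {x} {y} xy q-x) with alternates
...   | inj₁ balanced = inj₂ (cong suc (sym balanced))
...   | inj₂ ahead    = inj₁ (sym ahead)

path-countParity : ∀ q (xs : List (Vertex n)) → Linked Adj xs → 2 * countParity q xs ≤ suc (length xs)
path-countParity q []       _      = z≤n
path-countParity q (x ∷ xs) linked with q ≟ᵇ parity x
  | Linked⇒Alternates (parity x) x xs linked (hasParity-parity x)
... | yes refl | alternates = begin
  2 * countParity q (x ∷ xs)                                   ≡⟨ cong (countParity q (x ∷ xs) +_) (+-identityʳ _) ⟩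
  countParity q (x ∷ xs) + countParity q (x ∷ xs)              ≤⟨ +-monoʳ-≤ (countParity q (x ∷ xs)) (leads-by-≤1 alternates) ⟩
  countParity q (x ∷ xs) + suc (countParity (not q) (x ∷ xs))  ≡⟨ +-suc _ _ ⟩
  suc (countParity q (x ∷ xs) + countParity (not q) (x ∷ xs))  ≡⟨ cong suc (length≡countParity+countParity q (x ∷ xs)) ⟨
  suc (length (x ∷ xs))                                        ∎
  where
  open ≤-Reasoning
  leads-by-≤1 : ∀ {a b} → a ≡ b ⊎ a ≡ suc b → a ≤ suc b
  leads-by-≤1 (inj₁ refl) = n≤1+n _
  leads-by-≤1 (inj₂ refl) = ≤-refl
... | no q≢ | alternates rewrite ¬-not q≢ = begin
  2 * countParity (not p) (x ∷ xs)                             ≡⟨ cong (countParity (not p) (x ∷ xs) +_) (+-identityʳ _) ⟩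
  countParity (not p) (x ∷ xs) + countParity (not p) (x ∷ xs)  ≤⟨ +-monoˡ-≤ (countParity (not p) (x ∷ xs)) (trails alternates) ⟩
  countParity p (x ∷ xs) + countParity (not p) (x ∷ xs)        ≡⟨ length≡countParity+countParity p (x ∷ xs) ⟨
  length (x ∷ xs)                                              ≤⟨ n≤1+n _ ⟩
  suc (length (x ∷ xs))                                        ∎
  where
  p = parity x
  open ≤-Reasoning
  trails : ∀ {a b} → a ≡ b ⊎ a ≡ suc b → b ≤ a
  trails (inj₁ refl) = ≤-refl
  trails (inj₂ refl) = n≤1+n _

-- By counting, the covered neighbours of x are all the members of L of their parity.
CoversNeighboursExcept⇒Adj : (L : List (Vertex n)) → ∀ x y → CoversNeighboursExcept L x y →
  countParity (not (parity x)) L < n → ∀ {z} → z ∈ L → hasParity (not (parity x)) z ≡ true → Adj x z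
CoversNeighboursExcept⇒Adj L x y covers count< z∈L q-z =
  adjacentᵇ⇒Adj x _ (Equivalence.from T-≡
    (countᵇ-mono-tight (adjacentᵇ x) (hasParity (not (parity x))) L adjacent⇒parity
      (s≤s⁻¹ (≤-trans count< (CoversNeighboursExcept⇒n≤1+countᵇ (adjacentᵇ x) L x y covers
        (λ w xw → Equivalence.to T-≡ (Adj⇒adjacentᵇ x w xw)))))
      z∈L q-z))
  where
  adjacent⇒parity : ∀ w → adjacentᵇ x w ≡ true → hasParity (not (parity x)) w ≡ true
  adjacent⇒parity w e =
    Adj⇒hasParity-not (parity x) {x} {w} (adjacentᵇ⇒Adj x w (Equivalence.from T-≡ e)) (hasParity-parity x)

-- The vertices removed around an isolated edge induce a matching, so they contain no path on three vertices.
IsolatesEdge⇒no-P₃ : (L : List (Vertex n)) → (∀ q → countParity q L < n) → IsolatesEdge L →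
  ∀ {z₁ z₂ z₃} → z₁ ∈ L → z₂ ∈ L → z₃ ∈ L → Adj z₁ z₂ → Adj z₂ z₃ → z₁ ≡ z₃
IsolatesEdge⇒no-P₃ L count< (u , v , uv , u∉L , v∉L , covers-u , covers-v) = no-P₃
  where
  ∉⇒≢ : ∀ {a z} → a ∉ L → z ∈ L → z ≢ a
  ∉⇒≢ a∉L z∈L refl = a∉L z∈L
  parity-v : parity v ≡ not (parity u)
  parity-v = Adj⇒parity-not {x = u} {v} uv
  adj-u : ∀ {z} → z ∈ L → hasParity (not (parity u)) z ≡ true → Adj u z
  adj-u = CoversNeighboursExcept⇒Adj L u v covers-u (count< _)
  adj-v : ∀ {z} → z ∈ L → hasParity (parity u) z ≡ true → Adj v z
  adj-v {z} z∈ pu-z = CoversNeighboursExcept⇒Adj L v u covers-v (count< _) z∈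
    (subst (λ r → hasParity r z ≡ true) (sym (trans (cong not parity-v) (not-involutive (parity u)))) pu-z)
  neighbour-parity : ∀ a b → Adj a b → hasParity (not (parity u)) a ≡ true → hasParity (parity u) b ≡ true
  neighbour-parity a b ab h =
    subst (λ r → hasParity r b ≡ true) (not-involutive (parity u)) (Adj⇒hasParity-not _ {a} {b} ab h)
  neighbour-parity′ : ∀ a b → Adj a b → hasParity (parity u) a ≡ true → hasParity (not (parity u)) b ≡ true
  neighbour-parity′ a b ab h = Adj⇒hasParity-not _ {a} {b} ab h
  no-P₃ : ∀ {z₁ z₂ z₃} → z₁ ∈ L → z₂ ∈ L → z₃ ∈ L → Adj z₁ z₂ → Adj z₂ z₃ → z₁ ≡ z₃
  no-P₃ {z₁} {z₂} {z₃} z₁∈ z₂∈ z₃∈ z₁z₂ z₂z₃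
    with hasParity-either (not (parity u)) z₂
  ... | inj₁ ¬pu-z₂ =
    fourth-corner-unique v u z₁ z₂ z₃ (Adj-sym {x = u} {v} uv)
      (adj-v z₁∈ (neighbour-parity z₂ z₁ z₁z₂-sym ¬pu-z₂)) (∉⇒≢ u∉L z₁∈)
      (adj-v z₃∈ (neighbour-parity z₂ z₃ z₂z₃ ¬pu-z₂)) (∉⇒≢ u∉L z₃∈)
      (adj-u z₂∈ ¬pu-z₂) (∉⇒≢ v∉L z₂∈) z₁z₂ (Adj-sym {x = z₂} {z₃} z₂z₃)
    where
    z₁z₂-sym : Adj z₂ z₁
    z₁z₂-sym = Adj-sym {x = z₁} {z₂} z₁z₂
  ... | inj₂ ¬¬pu-z₂ =
    fourth-corner-unique u v z₁ z₂ z₃ uv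
      (adj-u z₁∈ (neighbour-parity′ z₂ z₁ z₁z₂-sym pu-z₂)) (∉⇒≢ v∉L z₁∈)
      (adj-u z₃∈ (neighbour-parity′ z₂ z₃ z₂z₃ pu-z₂)) (∉⇒≢ v∉L z₃∈)
      (adj-v z₂∈ pu-z₂) (∉⇒≢ u∉L z₂∈) z₁z₂ (Adj-sym {x = z₂} {z₃} z₂z₃)
    where
    z₁z₂-sym : Adj z₂ z₁
    z₁z₂-sym = Adj-sym {x = z₁} {z₂} z₁z₂
    pu-z₂ : hasParity (parity u) z₂ ≡ true
    pu-z₂ = subst (λ r → hasParity r z₂ ≡ true) (not-involutive (parity u)) ¬¬pu-z₂

ceilDiv-<⇒*< : ∀ a d m .{{_ : NonZero d}} → m < ceilDiv a d → m * d < a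
ceilDiv-<⇒*< a (suc d) m m<⌈a/d⌉ = +-cancelʳ-< d (m * suc d) a (begin-strict
  m * suc d + d                   <⟨ +-monoʳ-< (m * suc d) (n<1+n d) ⟩
  m * suc d + suc d               ≡⟨ +-comm (m * suc d) (suc d) ⟩
  suc m * suc d                   ≤⟨ *-monoˡ-≤ (suc d) m<⌈a/d⌉ ⟩
  (a + suc d ∸ 1) / suc d * suc d ≤⟨ m/n*n≤m (a + suc d ∸ 1) (suc d) ⟩
  a + suc d ∸ 1                   ≡⟨ cong (_∸ 1) (+-suc a d) ⟩
  a + d                           ∎)
  where open ≤-Reasoning

-- d is k + 1 for odd k and k for even k: an even number that still bounds twice the size of
-- a parity class of any path on at most k vertices.
bound-witness : ∀ n k m → 3 ≤ k → m < bound n k →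
  Σ ℕ λ d → (∀ c → 2 * c ≤ suc k → 2 * c ≤ d) × m * d < 2 * n × 4 ≤ d
bound-witness n (suc k) m (s≤s 2≤k) m<bound with suc k % 2 in parity-k
... | suc zero = suc (suc k) , (λ c 2c≤ → 2c≤) , ceilDiv-<⇒*< (2 * n) (suc (suc k)) m m<bound , s≤s (s≤s 2≤k)
... | zero = suc k , halve , ceilDiv-<⇒*< (2 * n) (suc k) m m<bound , four k 2≤k parity-k
  where
  k≡2*half : suc k ≡ 2 * (suc k / 2)
  k≡2*half = trans (m≡m%n+[m/n]*n (suc k) 2) (trans (cong (_+ (suc k / 2) * 2) parity-k) (*-comm (suc k / 2) 2))
  halve : ∀ c → 2 * c ≤ suc (suc k) → 2 * c ≤ suc k
  halve c 2c≤ = subst (2 * c ≤_) (sym k≡2*half) (*-monoʳ-≤ 2 (c≤half (subst (λ e → 2 * c ≤ suc e) k≡2*half 2c≤)))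
    where
    c≤half : 2 * c ≤ suc (2 * (suc k / 2)) → c ≤ suc k / 2
    c≤half 2c≤ with c ≤? suc k / 2
    ... | yes c≤ = c≤
    ... | no c≰  = ⊥-elim (<-irrefl refl (≤-trans (subst (_≤ 2 * c) (*-suc 2 _) (*-monoʳ-≤ 2 (≰⇒> c≰))) 2c≤))
  four : ∀ k → 2 ≤ k → suc k % 2 ≡ 0 → 4 ≤ suc k
  four (suc zero)          (s≤s ()) _
  four (suc (suc zero))    _ ()
  four (suc (suc (suc k))) _ _ = s≤s (s≤s (s≤s (s≤s z≤n)))
... | suc (suc r) =
  ⊥-elim (<-irrefl refl (≤-trans (s≤s (s≤s z≤n)) (≤-trans (≤-reflexive (sym parity-k)) (≤-pred (m%n<n (suc k) 2)))))

n≤1+m⇒2n≤m*d : ∀ n m d → 3 ≤ n → n ≤ suc m → 4 ≤ d → 2 * n ≤ m * d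
n≤1+m⇒2n≤m*d n m d 3≤n n≤1+m 4≤d = begin
  2 * n        ≤⟨ *-monoʳ-≤ 2 n≤1+m ⟩
  2 * suc m    ≤⟨ *-monoʳ-≤ 2 (subst (_≤ m + m) (+-comm m 1) (+-monoʳ-≤ m 1≤m)) ⟩
  2 * (m + m)  ≡⟨ double-double m ⟩
  m * 4        ≤⟨ *-monoʳ-≤ m 4≤d ⟩
  m * d        ∎
  where
  open ≤-Reasoning
  1≤m : 1 ≤ m
  1≤m = ≤-pred (≤-trans (s≤s (s≤s z≤n)) (≤-trans 3≤n n≤1+m))
  double-double : ∀ m → 2 * (m + m) ≡ m * 4
  double-double = solve-∀

covered : ∀ {k} → List (PathSub n k) → List (Vertex n)
covered F = concat (map verts F)

Covered⇒∈covered : ∀ {k} (F : List (PathSub n k)) {v} → Covered F v → v ∈ covered F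
Covered⇒∈covered F v∈F = ∈-concat⁺ (Any.map⁺ v∈F)

∈covered⇒Covered : ∀ {k} (F : List (PathSub n k)) {v} → v ∈ covered F → Covered F v
∈covered⇒Covered F v∈ = Any.map⁻ (∈-concat⁻ (map verts F) v∈)

countParity-covered≤ : ∀ {k} q d (F : List (PathSub n k)) → (∀ (P : PathSub n k) → 2 * countParity q (verts P) ≤ d) →
                       2 * countParity q (covered F) ≤ length F * d
countParity-covered≤ q d []      per-path = z≤n
countParity-covered≤ q d (P ∷ F) per-path = begin
  2 * countParity q (verts P ++ covered F)                          ≡⟨ cong (2 *_) (countᵇ-++ (hasParity q) (verts P) _) ⟩
  2 * (countParity q (verts P) + countParity q (covered F))         ≡⟨ *-distribˡ-+ 2 (countParity q (verts P)) _ ⟩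
  2 * countParity q (verts P) + 2 * countParity q (covered F)       ≤⟨ +-mono-≤ (per-path P) (countParity-covered≤ q d F per-path) ⟩
  d + length F * d                                                  ∎
  where open ≤-Reasoning

countParity-covered≤length : ∀ {k} q (F : List (PathSub n k)) → All (λ (P : PathSub n k) → countParity q (verts P) ≤ 1) F →
                             countParity q (covered F) ≤ length F
countParity-covered≤length q []      []          = z≤n
countParity-covered≤length q (P ∷ F) (P≤1 ∷ F≤1) = begin
  countParity q (verts P ++ covered F)                     ≡⟨ countᵇ-++ (hasParity q) (verts P) _ ⟩
  countParity q (verts P) + countParity q (covered F)      ≤⟨ +-mono-≤ P≤1 (countParity-covered≤length q F F≤1) ⟩
  suc (length F)                                           ∎
  where open ≤-Reasoning

module FewPaths (n k : ℕ) (3≤n : 3 ≤ n) (3≤k : 3 ≤ k) (F : List (PathSub n k)) (few : length F < bound n k) where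

  L : List (Vertex n)
  L = covered F

  witness : Σ ℕ λ d → (∀ c → 2 * c ≤ suc k → 2 * c ≤ d) × length F * d < 2 * n × 4 ≤ d
  witness = bound-witness n k (length F) 3≤k few

  d : ℕ
  d = proj₁ witness

  per-path-bound : ∀ c → 2 * c ≤ suc k → 2 * c ≤ d
  per-path-bound = proj₁ (proj₂ witness)

  few·d<2n : length F * d < 2 * n
  few·d<2n = proj₁ (proj₂ (proj₂ witness))

  4≤d : 4 ≤ d
  4≤d = proj₂ (proj₂ (proj₂ witness))

  count< : ∀ q → countParity q L < n
  count< q = *-cancelˡ-< 2 _ _ (≤-<-trans (countParity-covered≤ q d F per-path) few·d<2n)
    where
    per-path : ∀ (P : PathSub n k) → 2 * countParity q (verts P) ≤ d
    per-path P = per-path-bound (countParity q (verts P))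
                   (≤-trans (path-countParity q (verts P) (linked P)) (s≤s (bounded P)))

  ¬isolates : ¬ IsolatesEdge L
  ¬isolates isolates with any? (λ P → 3 ≤? length (verts P)) F
  ... | yes long = let (P , P∈F , 3≤|P|) = find long in no-long-path P P∈F (verts P) refl 3≤|P|
    where
    no-long-path : ∀ P → P ∈ F → ∀ vs → verts P ≡ vs → 3 ≤ length vs → ⊥
    no-long-path P P∈F (_ ∷ [])             refl (s≤s ())
    no-long-path P P∈F (_ ∷ _ ∷ [])         refl (s≤s (s≤s ()))
    no-long-path P P∈F (z₁ ∷ z₂ ∷ z₃ ∷ _) refl _ with linked P | distinct P
    ... | z₁z₂ ∷ z₂z₃ ∷ _ | (_ ∷ z₁≢z₃ ∷ _) ∷ _ =
      z₁≢z₃ (IsolatesEdge⇒no-P₃ L count< isolates (in-L (here refl)) (in-L (there (here refl)))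
               (in-L (there (there (here refl)))) z₁z₂ z₂z₃)
      where
      in-L : ∀ {z} → z ∈ verts P → z ∈ L
      in-L z∈ = ∈-concat⁺′ z∈ (∈-map⁺ verts P∈F)
  ... | no ¬long = <-irrefl refl (≤-<-trans (n≤1+m⇒2n≤m*d n (length F) d 3≤n n≤1+|F| 4≤d) few·d<2n)
    where
    short : ∀ P → P ∈ F → length (verts P) ≤ 2
    short P P∈F = ≤-pred (≰⇒> (¬long ∘ lose P∈F))
    at-most-one : All (λ (P : PathSub n k) → countParity true (verts P) ≤ 1) F
    at-most-one = All.tabulate λ {P} P∈F → ≤-pred (*-cancelˡ-< 2 _ 2
      (≤-trans (s≤s (path-countParity true (verts P) (linked P))) (s≤s (s≤s (short P P∈F)))))
    n≤1+|F| : n ≤ suc (length F)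
    n≤1+|F| = ≤-trans (IsolatesEdge⇒n≤1+countParity L isolates true)
                      (s≤s (countParity-covered≤length true F at-most-one))

  not-cut : ¬ IsSubstructureCut F
  not-cut (inj₁ (x , y , x-remains , y-remains , ¬x↝y)) =
    ¬x↝y (Reach-mono (λ v v∉L → v∉L ∘ Covered⇒∈covered F)
           (smallCutConnected n 3≤n L count< ¬isolates x y
              (x-remains ∘ ∈covered⇒Covered F) (y-remains ∘ ∈covered⇒Covered F)))
  not-cut (inj₂ (u , _ , only-u)) =
    let (z , uz , z∉L) = countParity<⇒HasAliveNeighbour L u (count< _) in
    Adj-irrefl {x = u} (subst (Adj u) (only-u z (z∉L ∘ Covered⇒∈covered F)) uz)

lemma12 : (n k : ℕ) → 3 ≤ n → 3 ≤ k → k ≤ 2 ^ (n ∸ 1) →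
    (F : List (PathSub n k)) → IsSubstructureCut F →
    bound n k ≤ length F
lemma12 n k 3≤n 3≤k _ F cut with bound n k ≤? length F
... | yes enough = enough
... | no ≰       = ⊥-elim (FewPaths.not-cut n k 3≤n 3≤k F (≰⇒> ≰) cut)
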